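{- Let $\alpha,\beta$ be coprime integers with $\beta(\alpha-8\beta)(\alpha+8\beta)\neq0$, $a = \alpha+8\beta$, $E: y^2 + axy + \beta a^2y = x^3 + \beta a x^2$, and let $p$ be an odd prime with $p\mid\beta$ or $p\mid(\alpha+8\beta)$ (these are mutually exclusive). Then $(0,0)$ is a point of order $4$ on $E$ with singular reduction modulo $p$, and its Fueter coordinate is $T = 1$. Moreover, for every odd $n\ge1$: if $p\mid\beta$, then $v_p(\Psi_n(0)) = \frac{3n^2-3}{8}v_p(\beta)$ and $v_p(F_n(1)) = -\frac{n^2-1}{8}v_p(\beta)$; if $p\mid(\alpha+8\beta)$, then $v_p(\Psi_n(0)) = \frac{5n^2-5}{8}v_p(\alpha+8\beta)$ and $v_p(F_n(1)) = \frac{n^2-1}{8}v_p(\alpha+8\beta)$.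
   Context: For odd $n$, $\Psi_n(x) = n\prod'_{P\in E[n]\setminus\{O\}}(x - x(P))$ is the $n$-th division polynomial of $E$ (one factor per pair $\{P,-P\}$), and $F_n(T) = \prod'_{P\in E[n]\setminus\{O\}}(T - T(P))$ is the $n$-th Fueter polynomial, where $T(P) = \frac{a\beta}{x(P)+a\beta}$ is the coordinate on the Fueter model $T_1^2 = T(4T^2 + \frac{\alpha}{\beta}T+4)$ obtained via $x = \frac{a\beta}{T} - a\beta$; $F_n$ has coefficients in $\mathbb{Q}$. $v_p$ is the $p$-adic valuation on $\mathbb{Q}$. -}

module Defs where

open import Data.Nat as ℕ using (ℕ; zero; suc; _∸_)
open import Data.Nat.DivMod using (_/_; _%_)
open import Data.Nat.Divisibility as ℕD using ()
open import Data.Integer as ℤ using (ℤ; +_; +[1+_]; -[1+_])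
open import Data.Rational as ℚ using (ℚ; mkℚ; 0ℚ; 1ℚ; _÷_)
open import Data.List using (List; []; _∷_; map)
open import Data.Product using (Σ; _×_)
open import Data.Unit using (⊤)
open import Relation.Binary.PropositionalEquality using (_≡_; _≢_)
open import Relation.Nullary using (¬_)

ι : ℤ → ℚ
ι z = z ℚ./ 1

-- total division on ℚ (q / 0 := 0); only used where the paper's
-- expressions are defined (nonzero denominators)
_⊘_ : ℚ → ℚ → ℚ
p ⊘ mkℚ (+ zero) _ _ = 0ℚ
p ⊘ q@(mkℚ +[1+ n ] _ _) = p ÷ q
p ⊘ q@(mkℚ -[1+ n ] _ _) = p ÷ q

infixl 8 _^ℚ_
_^ℚ_ : ℚ → ℕ → ℚ
q ^ℚ zero = 1ℚ
q ^ℚ suc k = q ℚ.* (q ^ℚ k)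

ValZ : ℕ → ℤ → ℕ → Set
ValZ p z k = (z ≢ + 0) × (p ℕ.^ k) ℕD.∣ ℤ.∣ z ∣ × ¬ ((p ℕ.^ suc k) ℕD.∣ ℤ.∣ z ∣)

ValQ : ℕ → ℚ → ℤ → Set
ValQ p q k = Σ ℕ λ a → Σ ℕ λ b →
  ValZ p (ℚ.↥ q) a × ValZ p (ℚ.↧ q) b × (k ≡ (+ a) ℤ.- (+ b))

-- Long Weierstrass curves y² + a1 xy + a3 y = x³ + a2 x² + a4 x + a6

record Weierstrass (A : Set) : Set where
  constructor weierstrass
  field a1 a2 a3 a4 a6 : A

aOf : ℤ → ℤ → ℤ
aOf α β = α ℤ.+ (+ 8) ℤ.* β

E-ℤ : ℤ → ℤ → Weierstrass ℤ
E-ℤ α β = weierstrass a (β ℤ.* a) (β ℤ.* a ℤ.* a) (+ 0) (+ 0)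
  where a = aOf α β

E-ℚ : ℤ → ℤ → Weierstrass ℚ
E-ℚ α β = weierstrass (ι a1) (ι a2) (ι a3) (ι a4) (ι a6)
  where open Weierstrass (E-ℤ α β)

data Pt : Set where
  O  : Pt
  pt : ℚ → ℚ → Pt

OnCurve : Weierstrass ℚ → Pt → Set
OnCurve E O = ⊤
OnCurve E (pt x y) =
  y ℚ.* y ℚ.+ a1 ℚ.* x ℚ.* y ℚ.+ a3 ℚ.* y
    ≡ x ℚ.* x ℚ.* x ℚ.+ a2 ℚ.* x ℚ.* x ℚ.+ a4 ℚ.* x ℚ.+ a6
  where open Weierstrass E

negPt : Weierstrass ℚ → Pt → Pt
negPt E O = O
negPt E (pt x y) = pt x (ℚ.- y ℚ.- a1 ℚ.* x ℚ.- a3)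
  where open Weierstrass E

open import Relation.Nullary using (yes; no)

-- chord-tangent addition (Silverman III.2.3)
addPt : Weierstrass ℚ → Pt → Pt → Pt
addPt E O Q = Q
addPt E P O = P
addPt E (pt x₁ y₁) (pt x₂ y₂) with x₁ ℚ.≟ x₂
... | no _ = third ((y₂ ℚ.- y₁) ⊘ (x₂ ℚ.- x₁))
  where
  open Weierstrass E
  third : ℚ → Pt
  third λ' = pt x₃ (ℚ.- (λ' ℚ.+ a1) ℚ.* x₃ ℚ.- (y₁ ℚ.- λ' ℚ.* x₁) ℚ.- a3)
    where x₃ = λ' ℚ.* λ' ℚ.+ a1 ℚ.* λ' ℚ.- a2 ℚ.- x₁ ℚ.- x₂
... | yes _ with (y₁ ℚ.+ y₂ ℚ.+ a1 ℚ.* x₂ ℚ.+ a3) ℚ.≟ 0ℚ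
  where open Weierstrass E
...   | yes _ = O
...   | no _ = third ((ι (+ 3) ℚ.* x₁ ℚ.* x₁ ℚ.+ ι (+ 2) ℚ.* a2 ℚ.* x₁ ℚ.+ a4 ℚ.- a1 ℚ.* y₁)
                      ⊘ (ι (+ 2) ℚ.* y₁ ℚ.+ a1 ℚ.* x₁ ℚ.+ a3))
  where
  open Weierstrass E
  third : ℚ → Pt
  third λ' = pt x₃ (ℚ.- (λ' ℚ.+ a1) ℚ.* x₃ ℚ.- (y₁ ℚ.- λ' ℚ.* x₁) ℚ.- a3)
    where x₃ = λ' ℚ.* λ' ℚ.+ a1 ℚ.* λ' ℚ.- a2 ℚ.- x₁ ℚ.- x₂

mulPt : Weierstrass ℚ → ℕ → Pt → Pt
mulPt E zero P = O
mulPt E (suc k) P = addPt E P (mulPt E k P)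

HasOrder : Weierstrass ℚ → ℕ → Pt → Set
HasOrder E n P = OnCurve E P × mulPt E n P ≡ O
  × ((k : ℕ) → 1 ℕ.≤ k → k ℕ.< n → mulPt E k P ≢ O)

-- An integral point (x₀,y₀) of an integral model reduces mod p to a
-- singular point of the reduced curve: the Weierstrass equation
-- F = y² + a1xy + a3y - x³ - a2x² - a4x - a6 and both partials vanish mod p.
SingularReduction : ℕ → Weierstrass ℤ → ℤ → ℤ → Set
SingularReduction p E x y =
  (+ p) ∣ (y ℤ.* y ℤ.+ a1 ℤ.* x ℤ.* y ℤ.+ a3 ℤ.* y
           ℤ.- x ℤ.* x ℤ.* x ℤ.- a2 ℤ.* x ℤ.* x ℤ.- a4 ℤ.* x ℤ.- a6)
  × (+ p) ∣ (a1 ℤ.* y ℤ.- (+ 3) ℤ.* x ℤ.* x ℤ.- (+ 2) ℤ.* a2 ℤ.* x ℤ.- a4)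
  × (+ p) ∣ ((+ 2) ℤ.* y ℤ.+ a1 ℤ.* x ℤ.+ a3)
  where
  open Weierstrass E
  open import Data.Integer.Divisibility using (_∣_)

-- Polynomials over ℚ as coefficient lists (constant term first)

Poly : Set
Poly = List ℚ

_⊕_ : Poly → Poly → Poly
[] ⊕ q = q
(a ∷ p) ⊕ [] = a ∷ p
(a ∷ p) ⊕ (b ∷ q) = (a ℚ.+ b) ∷ (p ⊕ q)

scale : ℚ → Poly → Poly
scale c = map (c ℚ.*_)

_⊗_ : Poly → Poly → Poly
[] ⊗ q = []
(a ∷ p) ⊗ q = scale a q ⊕ (0ℚ ∷ (p ⊗ q))

_⊖_ : Poly → Poly → Poly
p ⊖ q = p ⊕ scale (ℚ.- 1ℚ) q

evalP : Poly → ℚ → ℚ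
evalP [] x = 0ℚ
evalP (c ∷ p) x = c ℚ.+ x ℚ.* evalP p x

-- Division polynomials (standard recursion, Silverman Ex. 3.7),
-- written in x only: g n = ψ_n for odd n, g n = ψ_n / ψ_2 for even n,
-- using ψ_2² = 4x³ + b2x² + 2b4x + b6 =: f.
module DivPoly (E : Weierstrass ℚ) where
  open Weierstrass E
  c : ℤ → ℚ
  c = ι
  b2 b4 b6 b8 : ℚ
  b2 = a1 ℚ.* a1 ℚ.+ c (+ 4) ℚ.* a2
  b4 = c (+ 2) ℚ.* a4 ℚ.+ a1 ℚ.* a3
  b6 = a3 ℚ.* a3 ℚ.+ c (+ 4) ℚ.* a6
  b8 = a1 ℚ.* a1 ℚ.* a6 ℚ.+ c (+ 4) ℚ.* a2 ℚ.* a6 ℚ.- a1 ℚ.* a3 ℚ.* a4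
       ℚ.+ a2 ℚ.* a3 ℚ.* a3 ℚ.- a4 ℚ.* a4

  f ψ3 ψ4/ψ2 : Poly
  f = b6 ∷ c (+ 2) ℚ.* b4 ∷ b2 ∷ c (+ 4) ∷ []
  ψ3 = b8 ∷ c (+ 3) ℚ.* b6 ∷ c (+ 3) ℚ.* b4 ∷ b2 ∷ c (+ 3) ∷ []
  ψ4/ψ2 = (b4 ℚ.* b8 ℚ.- b6 ℚ.* b6) ∷ (b2 ℚ.* b8 ℚ.- b4 ℚ.* b6)
          ∷ c (+ 10) ℚ.* b8 ∷ c (+ 10) ℚ.* b6 ∷ c (+ 5) ℚ.* b4 ∷ b2 ∷ c (+ 2) ∷ []

  cube : Poly → Poly
  cube p = p ⊗ (p ⊗ p)

  sq : Poly → Poly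
  sq p = p ⊗ p

  -- first argument is fuel (n suffices for index n)
  g : ℕ → ℕ → Poly
  g zero n = []
  g (suc k) zero = []
  g (suc k) 1 = 1ℚ ∷ []
  g (suc k) 2 = 1ℚ ∷ []
  g (suc k) 3 = ψ3
  g (suc k) 4 = ψ4/ψ2
  g (suc k) n@(suc (suc (suc (suc (suc _))))) with n % 2 | (n / 2) % 2
  ... | 1 | 0 = (sq f ⊗ (g k (m ℕ.+ 2) ⊗ cube (g k m))) ⊖ (g k (m ∸ 1) ⊗ cube (g k (m ℕ.+ 1)))
    where m = n / 2
  ... | 1 | _ = (g k (m ℕ.+ 2) ⊗ cube (g k m)) ⊖ (sq f ⊗ (g k (m ∸ 1) ⊗ cube (g k (m ℕ.+ 1))))
    where m = n / 2
  ... | _ | _ = g k m ⊗ ((g k (m ℕ.+ 2) ⊗ sq (g k (m ∸ 1))) ⊖ (g k (m ∸ 2) ⊗ sq (g k (m ℕ.+ 1))))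
    where m = n / 2

  Ψ : ℕ → Poly
  Ψ n = g n n

Ψ : ℤ → ℤ → ℕ → ℚ → ℚ
Ψ α β n x = evalP (DivPoly.Ψ (E-ℚ α β) n) x

fueterT : ℤ → ℤ → ℚ → ℚ
fueterT α β x = ι (aOf α β ℤ.* β) ⊘ (x ℚ.+ ι (aOf α β ℤ.* β))

-- With s = aβ, m = (n²-1)/2 and
-- Ψ_n(x) = Σ_k c_k x^k, substituting x = s/T - s gives
--   F_n(T) = T^m Ψ_n(s/T - s) / Ψ_n(-s) = (Σ_k c_k s^k (1-T)^k T^(m-k)) / Ψ_n(-s),
-- the monic polynomial whose roots are the T(P), one per pair {P,-P}.
F : ℤ → ℤ → ℕ → ℚ → ℚ
F α β n t = hom 0 (DivPoly.Ψ (E-ℚ α β) n) ⊘ Ψ α β n (ℚ.- s)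
  where
  s = ι (aOf α β ℤ.* β)
  m = (n ℕ.* n ∸ 1) / 2
  hom : ℕ → Poly → ℚ
  hom k [] = 0ℚ
  hom k (c ∷ cs) = c ℚ.* (s ^ℚ k) ℚ.* ((1ℚ ℚ.- t) ^ℚ k) ℚ.* (t ^ℚ (m ∸ k)) ℚ.+ hom (suc k) cs

{-# OPTIONS --safe #-}
module Submission where

-- E is the Tate normal form y² + a1 xy + a1a2 y = x³ + a2 x² with a1 = a, a2 = βa, in which (0, 0)
-- has order 4 and 2(0, 0) = (-a2, 0). For odd n = 2m + 1 the recursion writes ψₙ as a difference
-- of ψ_{m+2}ψ_m³ and ψ_{m-1}ψ_{m+1}³; the product with even indices carries the factor f² = ψ₂⁴,
-- and one of its indices is a multiple of 4. So it vanishes at x = 0, where ψ₄ and hence every ψ₄ⱼ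
-- vanishes, and at x = -a2, a root of f. By induction Ψₙ(x) = ±ψ₃(x)^((n²-1)/8) at these two
-- points, with ψ₃(0) = β³a⁵ and ψ₃(-a2) = -β⁴a⁴. The substitution x = aβ/T - aβ gives
-- Fₙ(1) = Ψₙ(0)/Ψₙ(-aβ) = ±(a/β)^((n²-1)/8). As α and β are coprime, p divides exactly one of β
-- and a, and the valuations can be read off.

open import Defs
open import Data.Nat as ℕ using (ℕ; _∸_)
open import Data.Nat.DivMod using (_/_; _%_)
open import Data.Nat.Primality using (Prime)
open import Data.Nat.Coprimality using (Coprime)
open import Data.Integer as ℤ using (ℤ; +_; -_)
open import Data.Rational using (0ℚ; 1ℚ)
open import Data.Product using (_×_)
open import Data.Sum using (_⊎_)
open import Relation.Binary.PropositionalEquality using (_≡_; _≢_)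
open import Relation.Nullary using (¬_)

open import Data.Nat using (zero; suc; _+_; _*_; _^_; _≤_; s≤s; NonZero)
import Data.Nat.Properties as ℕP
import Data.Nat.DivMod as ℕDM
import Data.Nat.Divisibility as ℕD
import Data.Nat.Coprimality as Coprimality
open import Data.Nat.Primality using (euclidsLemma; prime⇒nonZero; prime⇒nonTrivial)
import Data.Nat.Tactic.RingSolver as ℕSolver
import Data.Integer.Properties as ℤP
import Data.Integer.Divisibility.Signed as ℤDS
import Data.Integer.Tactic.RingSolver as ℤSolver
open import Data.Rational as ℚ using (ℚ; mkℚ)
import Data.Rational.Properties as ℚP
import Data.Rational.Unnormalised as ℚᵘ
import Data.Rational.Unnormalised.Properties as ℚᵘP
open import Data.List using ([]; _∷_)
open import Data.Product using (Σ-syntax; _,_; proj₁; proj₂)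
open import Data.Sum using (inj₁; inj₂; [_,_]; swap) renaming (map to ⊎-map)
open import Data.Empty using (⊥-elim)
open import Function using (_∘_)
open import Level using (0ℓ)
open import Relation.Nullary using (yes; no)
open import Relation.Nullary.Decidable using (dec⇒maybe)
open import Relation.Binary.PropositionalEquality using (refl; sym; trans; cong; cong₂; subst; subst₂; module ≡-Reasoning)
open import Tactic.RingSolver using (solve-∀)
open import Tactic.RingSolver.Core.AlmostCommutativeRing using (AlmostCommutativeRing; fromCommutativeRing)

ℚ-ring : AlmostCommutativeRing 0ℓ 0ℓ
ℚ-ring = fromCommutativeRing ℚP.+-*-commutativeRing (λ x → dec⇒maybe (0ℚ ℚ.≟ x))

neg-involutive : ∀ x → ℚ.- (ℚ.- x) ≡ x
neg-involutive = solve-∀ ℚ-ring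

infix 10 _² _³
_² _³ : ℚ → ℚ
x ² = x ℚ.* x
x ³ = x ℚ.* x ²

⊘≡*1/ : ∀ p q (q≢0 : q ≢ 0ℚ) → p ⊘ q ≡ p ℚ.* (ℚ.1/ q) {{ℚ.≢-nonZero q≢0}}
⊘≡*1/ p q@(mkℚ (+ zero) _ _) q≢0 = ⊥-elim (q≢0 (ℚP.↥p≡0⇒p≡0 q refl))
⊘≡*1/ p (mkℚ ℤ.+[1+ _ ] _ _) _ = refl
⊘≡*1/ p (mkℚ ℤ.-[1+ _ ] _ _) _ = refl

⊘-cancelʳ : ∀ p q → q ≢ 0ℚ → (p ⊘ q) ℚ.* q ≡ p
⊘-cancelʳ p q q≢0 = begin
  (p ⊘ q) ℚ.* q         ≡⟨ cong (ℚ._* q) (⊘≡*1/ p q q≢0) ⟩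
  p ℚ.* (ℚ.1/ q) ℚ.* q  ≡⟨ ℚP.*-assoc p _ q ⟩
  p ℚ.* ((ℚ.1/ q) ℚ.* q) ≡⟨ cong (p ℚ.*_) (ℚP.*-inverseˡ q) ⟩
  p ℚ.* 1ℚ              ≡⟨ ℚP.*-identityʳ p ⟩
  p                     ∎
  where
  open ≡-Reasoning
  instance
    q≠0 : ℚ.NonZero q
    q≠0 = ℚ.≢-nonZero q≢0

*-⊘-cancel : ∀ p q → q ≢ 0ℚ → (p ℚ.* q) ⊘ q ≡ p
*-⊘-cancel p q q≢0 = begin
  (p ℚ.* q) ⊘ q          ≡⟨ ⊘≡*1/ (p ℚ.* q) q q≢0 ⟩
  p ℚ.* q ℚ.* (ℚ.1/ q)   ≡⟨ ℚP.*-assoc p q _ ⟩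
  p ℚ.* (q ℚ.* (ℚ.1/ q)) ≡⟨ cong (p ℚ.*_) (ℚP.*-inverseʳ q) ⟩
  p ℚ.* 1ℚ              ≡⟨ ℚP.*-identityʳ p ⟩
  p                     ∎
  where
  open ≡-Reasoning
  instance
    q≠0 : ℚ.NonZero q
    q≠0 = ℚ.≢-nonZero q≢0

⊘-self : ∀ q → q ≢ 0ℚ → q ⊘ q ≡ 1ℚ
⊘-self q q≢0 = trans (⊘≡*1/ q q q≢0) (ℚP.*-inverseʳ q)
  where
  instance
    q≠0 : ℚ.NonZero q
    q≠0 = ℚ.≢-nonZero q≢0

⊘-zeroˡ : ∀ {p} q → p ≡ 0ℚ → p ⊘ q ≡ 0ℚ
⊘-zeroˡ (mkℚ (+ zero) _ _)       refl = refl
⊘-zeroˡ q@(mkℚ ℤ.+[1+ _ ] _ _) refl = ℚP.*-zeroˡ (ℚ.1/ q)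
⊘-zeroˡ q@(mkℚ ℤ.-[1+ _ ] _ _) refl = ℚP.*-zeroˡ (ℚ.1/ q)

*-cancelʳ : ∀ {x y} z → z ≢ 0ℚ → x ℚ.* z ≡ y ℚ.* z → x ≡ y
*-cancelʳ {x} {y} z z≢0 eq = trans (sym (*-⊘-cancel x z z≢0)) (trans (cong (_⊘ z) eq) (*-⊘-cancel y z z≢0))

^ℚ-+ : ∀ c a b → c ^ℚ (a + b) ≡ c ^ℚ a ℚ.* c ^ℚ b
^ℚ-+ c zero    b = sym (ℚP.*-identityˡ (c ^ℚ b))
^ℚ-+ c (suc a) b = trans (cong (c ℚ.*_) (^ℚ-+ c a b)) (sym (ℚP.*-assoc c (c ^ℚ a) (c ^ℚ b)))

^ℚ-+-3* : ∀ c a b → c ^ℚ (a + 3 * b) ≡ c ^ℚ a ℚ.* (c ^ℚ b) ³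
^ℚ-+-3* c a b = begin
  c ^ℚ (a + 3 * b)                                  ≡⟨ ^ℚ-+ c a (3 * b) ⟩
  c ^ℚ a ℚ.* c ^ℚ (b + (b + (b + 0)))               ≡⟨ cong (c ^ℚ a ℚ.*_) (^ℚ-+ c b (b + (b + 0))) ⟩
  c ^ℚ a ℚ.* (c ^ℚ b ℚ.* c ^ℚ (b + (b + 0)))
    ≡⟨ cong (λ u → c ^ℚ a ℚ.* (c ^ℚ b ℚ.* u)) (^ℚ-+ c b (b + 0)) ⟩
  c ^ℚ a ℚ.* (c ^ℚ b ℚ.* (c ^ℚ b ℚ.* c ^ℚ (b + 0)))
    ≡⟨ cong (λ u → c ^ℚ a ℚ.* (c ^ℚ b ℚ.* (c ^ℚ b ℚ.* c ^ℚ u))) (ℕP.+-identityʳ b) ⟩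
  c ^ℚ a ℚ.* (c ^ℚ b) ³                            ∎
  where open ≡-Reasoning

^ℚ-distrib-* : ∀ x y t → (x ℚ.* y) ^ℚ t ≡ x ^ℚ t ℚ.* y ^ℚ t
^ℚ-distrib-* x y zero    = refl
^ℚ-distrib-* x y (suc t) = trans (cong ((x ℚ.* y) ℚ.*_) (^ℚ-distrib-* x y t)) (interchange x y (x ^ℚ t) (y ^ℚ t))
  where
  interchange : ∀ x y u v → x ℚ.* y ℚ.* (u ℚ.* v) ≡ x ℚ.* u ℚ.* (y ℚ.* v)
  interchange = solve-∀ ℚ-ring

infix 4 _≈±_
_≈±_ : ℚ → ℚ → Set
x ≈± y = x ≡ y ⊎ x ≡ ℚ.- y

≈±-trans : ∀ {x y z} → x ≈± y → y ≈± z → x ≈± z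
≈±-trans (inj₁ refl) y≈±z = y≈±z
≈±-trans (inj₂ refl) (inj₁ refl) = inj₂ refl
≈±-trans (inj₂ refl) (inj₂ refl) = inj₁ (neg-involutive _)

≈±-sym : ∀ {x y} → x ≈± y → y ≈± x
≈±-sym (inj₁ refl) = inj₁ refl
≈±-sym (inj₂ refl) = inj₂ (sym (neg-involutive _))

≈±-*-cong : ∀ {x y u v} → x ≈± y → u ≈± v → x ℚ.* u ≈± y ℚ.* v
≈±-*-cong             (inj₁ refl) (inj₁ refl) = inj₁ refl
≈±-*-cong {y = y} {v = v} (inj₁ refl) (inj₂ refl) = inj₂ (sym (ℚP.neg-distribʳ-* y v))
≈±-*-cong {y = y} {v = v} (inj₂ refl) (inj₁ refl) = inj₂ (sym (ℚP.neg-distribˡ-* y v))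
≈±-*-cong {y = y} {v = v} (inj₂ refl) (inj₂ refl) = inj₁ (neg-*-neg y v)
  where
  neg-*-neg : ∀ y v → ℚ.- y ℚ.* ℚ.- v ≡ y ℚ.* v
  neg-*-neg = solve-∀ ℚ-ring

≈±-³ : ∀ {x y} → x ≈± y → x ³ ≈± y ³
≈±-³ x≈±y = ≈±-*-cong x≈±y (≈±-*-cong x≈±y x≈±y)

≈±-cancelʳ : ∀ {x y} z → z ≢ 0ℚ → x ℚ.* z ≈± y ℚ.* z → x ≈± y
≈±-cancelʳ z z≢0 (inj₁ eq) = inj₁ (*-cancelʳ z z≢0 eq)
≈±-cancelʳ {y = y} z z≢0 (inj₂ eq) = inj₂ (*-cancelʳ z z≢0 (trans eq (ℚP.neg-distribˡ-* y z)))

≈±-≢0 : ∀ {x y} → x ≈± y → y ≢ 0ℚ → x ≢ 0ℚ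
≈±-≢0 (inj₁ refl) y≢0 = y≢0
≈±-≢0 (inj₂ refl) y≢0 -y≡0 = y≢0 (trans (sym (neg-involutive _)) (cong ℚ.-_ -y≡0))

≈±-minus-zeroˡ : ∀ {w z} d → w ≡ z ℚ.- d → z ≡ 0ℚ → w ≈± d
≈±-minus-zeroˡ d w≡z-d refl = inj₂ (trans w≡z-d (ℚP.+-identityˡ (ℚ.- d)))

≈±-minus-zeroʳ : ∀ {w z} d → w ≡ d ℚ.- z → z ≡ 0ℚ → w ≈± d
≈±-minus-zeroʳ d w≡d-z refl = inj₁ (trans w≡d-z (ℚP.+-identityʳ d))

quotient-≈± : ∀ {W V} x y z → V ≢ 0ℚ → z ≢ 0ℚ → W ≈± x ℚ.* z → V ≈± y ℚ.* z → (W ⊘ V) ℚ.* y ≈± x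
quotient-≈± {W} {V} x y z V≢0 z≢0 W≈±xz V≈±yz = ≈±-cancelʳ z z≢0
  (≈±-trans (inj₁ (ℚP.*-assoc (W ⊘ V) y z))
  (≈±-trans (≈±-*-cong {W ⊘ V} {W ⊘ V} (inj₁ refl) (≈±-sym V≈±yz))
  (≈±-trans (inj₁ (⊘-cancelʳ W V V≢0)) W≈±xz)))

*-³-zero : ∀ u a b → u ℚ.* a ≡ 0ℚ ⊎ u ℚ.* b ≡ 0ℚ → u ℚ.* (a ℚ.* b ³) ≡ 0ℚ
*-³-zero u a b (inj₁ ua≡0) = trans (regroup u a b) (trans (cong (ℚ._* b ³) ua≡0) (ℚP.*-zeroˡ (b ³)))
  where
  regroup : ∀ u a b → u ℚ.* (a ℚ.* (b ℚ.* (b ℚ.* b))) ≡ u ℚ.* a ℚ.* (b ℚ.* (b ℚ.* b))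
  regroup = solve-∀ ℚ-ring
*-³-zero u a b (inj₂ ub≡0) = trans (regroup u a b) (trans (cong (ℚ._* (a ℚ.* b ²)) ub≡0) (ℚP.*-zeroˡ (a ℚ.* b ²)))
  where
  regroup : ∀ u a b → u ℚ.* (a ℚ.* (b ℚ.* (b ℚ.* b))) ≡ u ℚ.* b ℚ.* (a ℚ.* (b ℚ.* b))
  regroup = solve-∀ ℚ-ring

ι-* : ∀ x y → ι (x ℤ.* y) ≡ ι x ℚ.* ι y
ι-* x y = trans (ℚP.fromℚᵘ-cong (ℚᵘP.≃-sym toℚᵘ-ιx*ιy)) (ℚP.fromℚᵘ-toℚᵘ (ι x ℚ.* ι y))
  where
  toℚᵘ-ιx*ιy : ℚ.toℚᵘ (ι x ℚ.* ι y) ℚᵘ.≃ ℚᵘ.mkℚᵘ (x ℤ.* y) 0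
  toℚᵘ-ιx*ιy = ℚᵘP.≃-trans (ℚP.toℚᵘ-homo-* (ι x) (ι y))
                 (ℚᵘP.*-cong (ℚP.toℚᵘ-fromℚᵘ (ℚᵘ.mkℚᵘ x 0)) (ℚP.toℚᵘ-fromℚᵘ (ℚᵘ.mkℚᵘ y 0)))

ι-^ : ∀ z k → ι (z ℤ.^ k) ≡ ι z ^ℚ k
ι-^ z zero    = refl
ι-^ z (suc k) = trans (ι-* z (z ℤ.^ k)) (cong (ι z ℚ.*_) (ι-^ z k))

ι-≢0 : ∀ {z} → z ≢ + 0 → ι z ≢ 0ℚ
ι-≢0 {z} z≢0 ιz≡0 with ℚᵘP.≃-trans (ℚᵘP.≃-sym (ℚP.toℚᵘ-fromℚᵘ (ℚᵘ.mkℚᵘ z 0))) (ℚP.toℚᵘ-cong ιz≡0)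
... | ℚᵘ.*≡* eq = z≢0 (trans (sym (ℤP.*-identityʳ z)) eq)

*-≢0 : ∀ {x y} → x ≢ + 0 → y ≢ + 0 → x ℤ.* y ≢ + 0
*-≢0 {x} x≢0 y≢0 = [ x≢0 , y≢0 ] ∘ ℤP.i*j≡0⇒i≡0∨j≡0 x

^-≢0 : ∀ {x} n → x ≢ + 0 → x ℤ.^ n ≢ + 0
^-≢0 {x} n x≢0 = x≢0 ∘ ℤP.i^n≡0⇒i≡0 x n

ι^-≢0 : ∀ {z} n → z ≢ + 0 → ι z ^ℚ n ≢ 0ℚ
ι^-≢0 {z} n z≢0 = subst (_≢ 0ℚ) (ι-^ z n) (ι-≢0 (^-≢0 n z≢0))

evalP-⊕ : ∀ p q x → evalP (p ⊕ q) x ≡ evalP p x ℚ.+ evalP q x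
evalP-⊕ []      q       x = sym (ℚP.+-identityˡ _)
evalP-⊕ (a ∷ p) []      x = sym (ℚP.+-identityʳ _)
evalP-⊕ (a ∷ p) (b ∷ q) x = trans (cong (λ v → a ℚ.+ b ℚ.+ x ℚ.* v) (evalP-⊕ p q x)) (regroup a b x _ _)
  where
  regroup : ∀ a b x u v → a ℚ.+ b ℚ.+ x ℚ.* (u ℚ.+ v) ≡ (a ℚ.+ x ℚ.* u) ℚ.+ (b ℚ.+ x ℚ.* v)
  regroup = solve-∀ ℚ-ring

evalP-scale : ∀ c p x → evalP (scale c p) x ≡ c ℚ.* evalP p x
evalP-scale c []      x = sym (ℚP.*-zeroʳ c)
evalP-scale c (a ∷ p) x = trans (cong (λ v → c ℚ.* a ℚ.+ x ℚ.* v) (evalP-scale c p x)) (regroup c a x _)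
  where
  regroup : ∀ c a x u → c ℚ.* a ℚ.+ x ℚ.* (c ℚ.* u) ≡ c ℚ.* (a ℚ.+ x ℚ.* u)
  regroup = solve-∀ ℚ-ring

evalP-⊗ : ∀ p q x → evalP (p ⊗ q) x ≡ evalP p x ℚ.* evalP q x
evalP-⊗ []      q x = sym (ℚP.*-zeroˡ (evalP q x))
evalP-⊗ (a ∷ p) q x = begin
  evalP (scale a q ⊕ (0ℚ ∷ (p ⊗ q))) x                 ≡⟨ evalP-⊕ (scale a q) (0ℚ ∷ (p ⊗ q)) x ⟩
  evalP (scale a q) x ℚ.+ (0ℚ ℚ.+ x ℚ.* evalP (p ⊗ q) x) ≡⟨ cong₂ (λ u v → u ℚ.+ (0ℚ ℚ.+ x ℚ.* v)) (evalP-scale a q x) (evalP-⊗ p q x) ⟩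
  a ℚ.* Q ℚ.+ (0ℚ ℚ.+ x ℚ.* (evalP p x ℚ.* Q))        ≡⟨ regroup a x (evalP p x) Q ⟩
  (a ℚ.+ x ℚ.* evalP p x) ℚ.* Q                         ∎
  where
  open ≡-Reasoning
  Q : ℚ
  Q = evalP q x
  regroup : ∀ a x u v → a ℚ.* v ℚ.+ (0ℚ ℚ.+ x ℚ.* (u ℚ.* v)) ≡ (a ℚ.+ x ℚ.* u) ℚ.* v
  regroup = solve-∀ ℚ-ring

evalP-⊖ : ∀ p q x → evalP (p ⊖ q) x ≡ evalP p x ℚ.- evalP q x
evalP-⊖ p q x = trans (evalP-⊕ p (scale (ℚ.- 1ℚ) q) x)
                      (cong (evalP p x ℚ.+_) (trans (evalP-scale (ℚ.- 1ℚ) q x) (minus-one (evalP q x))))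
  where
  minus-one : ∀ v → ℚ.- 1ℚ ℚ.* v ≡ ℚ.- v
  minus-one = solve-∀ ℚ-ring

data ParityView : ℕ → Set where
  even : ∀ i → ParityView (i * 2)
  odd  : ∀ i → ParityView (1 + i * 2)

parityView : ∀ n → ParityView n
parityView zero = even 0
parityView (suc n) with parityView n
... | even i = odd i
... | odd i  = even (suc i)

odd⇒1+m*2 : ∀ {n} → n % 2 ≡ 1 → Σ[ m ∈ ℕ ] n ≡ 1 + m * 2
odd⇒1+m*2 {n} n%2≡1 with parityView n
... | odd m  = m , refl
... | even i with trans (sym (ℕDM.m*n%n≡0 i 2)) n%2≡1
...   | ()

half-odd : ∀ m → (1 + m * 2) / 2 ≡ m
half-odd m = trans (ℕDM.+-distrib-/-∣ʳ 1 (ℕD.n∣m*n m {2})) (ℕDM.m*n/n≡m m 2)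

half-bound : ∀ c j {k} → c + j * 2 * 2 ≤ k → c + j * 2 ≤ k
half-bound c j = ℕP.≤-trans (ℕP.+-monoʳ-≤ c (ℕP.m≤m*n (j * 2) 2))

oddExponent : ℕ → ℕ
oddExponent n = (n * n ∸ 1) / 8

oddExponent-unique : ∀ n t → n * n ≡ 1 + t * 8 → oddExponent n ≡ t
oddExponent-unique n t eq = trans (cong (λ u → (u ∸ 1) / 8) eq) (ℕDM.m*n/n≡m t 8)

square-oddExponent : ∀ n t → n * n ≡ 1 + t * 8 → n * n ≡ 1 + oddExponent n * 8
square-oddExponent n t eq = trans eq (cong (λ u → 1 + u * 8) (sym (oddExponent-unique n t eq)))

odd-square : ∀ m → (1 + m * 2) * (1 + m * 2) ≡ 1 + oddExponent (1 + m * 2) * 8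
odd-square m with parityView m
... | even i = square-oddExponent (1 + i * 2 * 2) (i * (1 + i * 2)) (square i)
  where
  square : ∀ i → (1 + i * 2 * 2) * (1 + i * 2 * 2) ≡ 1 + i * (1 + i * 2) * 8
  square = ℕSolver.solve-∀
... | odd i = square-oddExponent (1 + (1 + i * 2) * 2) ((1 + i) * (1 + i * 2)) (square i)
  where
  square : ∀ i → (1 + (1 + i * 2) * 2) * (1 + (1 + i * 2) * 2) ≡ 1 + (1 + i) * (1 + i * 2) * 8
  square = ℕSolver.solve-∀

-- The surviving product ψ_a ψ_b³ in the recurrence for ψₙ, n = 2m + 1, has n² + 3 = a² + 3b².
oddExponent-step : ∀ n a b → n * n + 3 ≡ (1 + a * 2) * (1 + a * 2) + 3 * ((1 + b * 2) * (1 + b * 2))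
                 → oddExponent n ≡ oddExponent (1 + a * 2) + 3 * oddExponent (1 + b * 2)
oddExponent-step n a b eq = oddExponent-unique n _ (ℕP.+-cancelʳ-≡ 3 _ _ (begin
  n * n + 3                                                        ≡⟨ eq ⟩
  (1 + a * 2) * (1 + a * 2) + 3 * ((1 + b * 2) * (1 + b * 2))      ≡⟨ cong₂ (λ u w → u + 3 * w) (odd-square a) (odd-square b) ⟩
  1 + oddExponent (1 + a * 2) * 8 + 3 * (1 + oddExponent (1 + b * 2) * 8) ≡⟨ regroup (oddExponent (1 + a * 2)) (oddExponent (1 + b * 2)) ⟩
  1 + (oddExponent (1 + a * 2) + 3 * oddExponent (1 + b * 2)) * 8 + 3 ∎))
  where
  open ≡-Reasoning
  regroup : ∀ s t → 1 + s * 8 + 3 * (1 + t * 8) ≡ 1 + (s + 3 * t) * 8 + 3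
  regroup = ℕSolver.solve-∀

scaled-oddExponent : ∀ c {n} → n % 2 ≡ 1 → (c * n * n ∸ c) / 8 ≡ c * oddExponent n
scaled-oddExponent c {n} n-odd with odd⇒1+m*2 {n} n-odd
... | m , refl = begin
  (c * n * n ∸ c) / 8                     ≡⟨ cong (λ u → (u ∸ c) / 8) (trans (ℕP.*-assoc c n n) (cong (c *_) (odd-square m))) ⟩
  (c * (1 + oddExponent n * 8) ∸ c) / 8   ≡⟨ cong (λ u → (u ∸ c) / 8) (distribute c (oddExponent n)) ⟩
  (c + c * oddExponent n * 8 ∸ c) / 8     ≡⟨ cong (_/ 8) (ℕP.m+n∸m≡n c (c * oddExponent n * 8)) ⟩
  c * oddExponent n * 8 / 8               ≡⟨ ℕDM.m*n/n≡m (c * oddExponent n) 8 ⟩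
  c * oddExponent n                       ∎
  where
  open ≡-Reasoning
  distribute : ∀ c e → c * (1 + e * 8) ≡ c + c * e * 8
  distribute = ℕSolver.solve-∀

module DivisionValues (E : Weierstrass ℚ) where
  open DivPoly E using (f; ψ3; ψ4/ψ2; g; sq; cube)

  -- The recursive clause of `g` at n = 2m + r, with h = g k and s = m % 2.
  recurrence : (ℕ → Poly) → ℕ → ℕ → ℕ → Poly
  recurrence h m 1 0       = (sq f ⊗ (h (m + 2) ⊗ cube (h m))) ⊖ (h (m ∸ 1) ⊗ cube (h (m + 1)))
  recurrence h m 1 (suc _) = (h (m + 2) ⊗ cube (h m)) ⊖ (sq f ⊗ (h (m ∸ 1) ⊗ cube (h (m + 1))))
  recurrence h m _ _       = h m ⊗ ((h (m + 2) ⊗ sq (h (m ∸ 1))) ⊖ (h (m ∸ 2) ⊗ sq (h (m + 1))))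

  g-unfold : ∀ k x → g (suc k) (5 + x) ≡ recurrence (g k) ((5 + x) / 2) ((5 + x) % 2) (((5 + x) / 2) % 2)
  g-unfold k x with (5 + x) % 2 | ((5 + x) / 2) % 2
  ... | 0           | _     = refl
  ... | 1           | 0     = refl
  ... | 1           | suc _ = refl
  ... | suc (suc _) | _     = refl

  g-at : ∀ k x {m r s} → (5 + x) / 2 ≡ m → (5 + x) % 2 ≡ r → m % 2 ≡ s
       → g (suc k) (5 + x) ≡ recurrence (g k) m r s
  g-at k x refl refl refl = g-unfold k x

  module AtPoint (x : ℚ) where
    v : ℕ → ℕ → ℚ
    v k n = evalP (g k n) x

    f²ₓ : ℚ
    f²ₓ = evalP (sq f) x

    evalP-*-cube : ∀ p q → evalP (p ⊗ cube q) x ≡ evalP p x ℚ.* evalP q x ³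
    evalP-*-cube p q = trans (evalP-⊗ p (cube q) x)
                         (cong (evalP p x ℚ.*_) (trans (evalP-⊗ q (q ⊗ q) x) (cong (evalP q x ℚ.*_) (evalP-⊗ q q x))))

    evalP-*-sq : ∀ p q → evalP (p ⊗ sq q) x ≡ evalP p x ℚ.* evalP q x ²
    evalP-*-sq p q = trans (evalP-⊗ p (sq q) x) (cong (evalP p x ℚ.*_) (evalP-⊗ q q x))

    v-oddᵉ : ∀ k j → v (suc k) (1 + (2 + j * 2) * 2)
           ≡ f²ₓ ℚ.* (v k (4 + j * 2) ℚ.* v k (2 + j * 2) ³) ℚ.- v k (1 + j * 2) ℚ.* v k (3 + j * 2) ³
    v-oddᵉ k j = begin
      evalP (g (suc k) (1 + m * 2)) x
        ≡⟨ cong (λ p → evalP p x) (g-at k (j * 2 * 2) (half-odd m) (ℕDM.[m+kn]%n≡m%n 1 m 2) (ℕDM.m*n%n≡0 (1 + j) 2)) ⟩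
      evalP (recurrence (g k) m 1 0) x
        ≡⟨ evalP-⊖ (sq f ⊗ (g k (m + 2) ⊗ cube (g k m))) (g k (1 + j * 2) ⊗ cube (g k (m + 1))) x ⟩
      evalP (sq f ⊗ (g k (m + 2) ⊗ cube (g k m))) x ℚ.- evalP (g k (1 + j * 2) ⊗ cube (g k (m + 1))) x
        ≡⟨ cong₂ ℚ._-_ (trans (evalP-⊗ (sq f) (g k (m + 2) ⊗ cube (g k m)) x) (cong (f²ₓ ℚ.*_) (evalP-*-cube (g k (m + 2)) (g k m))))
                       (evalP-*-cube (g k (1 + j * 2)) (g k (m + 1))) ⟩
      f²ₓ ℚ.* (v k (m + 2) ℚ.* v k m ³) ℚ.- v k (1 + j * 2) ℚ.* v k (m + 1) ³
        ≡⟨ cong₂ (λ a b → f²ₓ ℚ.* (v k a ℚ.* v k m ³) ℚ.- v k (1 + j * 2) ℚ.* v k b ³) (ℕP.+-comm m 2) (ℕP.+-comm m 1) ⟩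
      f²ₓ ℚ.* (v k (4 + j * 2) ℚ.* v k m ³) ℚ.- v k (1 + j * 2) ℚ.* v k (3 + j * 2) ³ ∎
      where
      open ≡-Reasoning
      m : ℕ
      m = 2 + j * 2

    v-oddᵒ : ∀ k j → v (suc k) (1 + (3 + j * 2) * 2)
           ≡ v k (5 + j * 2) ℚ.* v k (3 + j * 2) ³ ℚ.- f²ₓ ℚ.* (v k (2 + j * 2) ℚ.* v k (4 + j * 2) ³)
    v-oddᵒ k j = begin
      evalP (g (suc k) (1 + m * 2)) x
        ≡⟨ cong (λ p → evalP p x) (g-at k (2 + j * 2 * 2) (half-odd m) (ℕDM.[m+kn]%n≡m%n 1 m 2) (ℕDM.[m+kn]%n≡m%n 1 (1 + j) 2)) ⟩
      evalP (recurrence (g k) m 1 1) x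
        ≡⟨ evalP-⊖ (g k (m + 2) ⊗ cube (g k m)) (sq f ⊗ (g k (2 + j * 2) ⊗ cube (g k (m + 1)))) x ⟩
      evalP (g k (m + 2) ⊗ cube (g k m)) x ℚ.- evalP (sq f ⊗ (g k (2 + j * 2) ⊗ cube (g k (m + 1)))) x
        ≡⟨ cong₂ ℚ._-_ (evalP-*-cube (g k (m + 2)) (g k m))
                       (trans (evalP-⊗ (sq f) (g k (2 + j * 2) ⊗ cube (g k (m + 1))) x)
                              (cong (f²ₓ ℚ.*_) (evalP-*-cube (g k (2 + j * 2)) (g k (m + 1))))) ⟩
      v k (m + 2) ℚ.* v k m ³ ℚ.- f²ₓ ℚ.* (v k (2 + j * 2) ℚ.* v k (m + 1) ³)
        ≡⟨ cong₂ (λ a b → v k a ℚ.* v k m ³ ℚ.- f²ₓ ℚ.* (v k (2 + j * 2) ℚ.* v k b ³)) (ℕP.+-comm m 2) (ℕP.+-comm m 1) ⟩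
      v k (5 + j * 2) ℚ.* v k m ³ ℚ.- f²ₓ ℚ.* (v k (2 + j * 2) ℚ.* v k (4 + j * 2) ³) ∎
      where
      open ≡-Reasoning
      m : ℕ
      m = 3 + j * 2

    v-even : ∀ k i → v (suc k) ((4 + i * 2) * 2)
           ≡ v k (4 + i * 2) ℚ.* (v k (6 + i * 2) ℚ.* v k (3 + i * 2) ² ℚ.- v k (2 + i * 2) ℚ.* v k (5 + i * 2) ²)
    v-even k i = begin
      evalP (g (suc k) (m * 2)) x
        ≡⟨ cong (λ p → evalP p x) (g-at k (3 + i * 2 * 2) (ℕDM.m*n/n≡m m 2) (ℕDM.m*n%n≡0 m 2) refl) ⟩
      evalP (g k m ⊗ ((g k (m + 2) ⊗ sq (g k (3 + i * 2))) ⊖ (g k (2 + i * 2) ⊗ sq (g k (m + 1))))) x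
        ≡⟨ evalP-⊗ (g k m) ((g k (m + 2) ⊗ sq (g k (3 + i * 2))) ⊖ (g k (2 + i * 2) ⊗ sq (g k (m + 1)))) x ⟩
      v k m ℚ.* evalP ((g k (m + 2) ⊗ sq (g k (3 + i * 2))) ⊖ (g k (2 + i * 2) ⊗ sq (g k (m + 1)))) x
        ≡⟨ cong (v k m ℚ.*_) (trans (evalP-⊖ (g k (m + 2) ⊗ sq (g k (3 + i * 2))) (g k (2 + i * 2) ⊗ sq (g k (m + 1))) x)
                                    (cong₂ ℚ._-_ (evalP-*-sq (g k (m + 2)) (g k (3 + i * 2))) (evalP-*-sq (g k (2 + i * 2)) (g k (m + 1))))) ⟩
      v k m ℚ.* (v k (m + 2) ℚ.* v k (3 + i * 2) ² ℚ.- v k (2 + i * 2) ℚ.* v k (m + 1) ²)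
        ≡⟨ cong₂ (λ a b → v k m ℚ.* (v k a ℚ.* v k (3 + i * 2) ² ℚ.- v k (2 + i * 2) ℚ.* v k b ²)) (ℕP.+-comm m 2) (ℕP.+-comm m 1) ⟩
      v k m ℚ.* (v k (6 + i * 2) ℚ.* v k (3 + i * 2) ² ℚ.- v k (2 + i * 2) ℚ.* v k (5 + i * 2) ²) ∎
      where
      open ≡-Reasoning
      m : ℕ
      m = 4 + i * 2

    quadruples-vanish : evalP ψ4/ψ2 x ≡ 0ℚ → ∀ k j → j * 2 * 2 ≤ k → v k (j * 2 * 2) ≡ 0ℚ
    quadruples-vanish ψ₄≡0 zero    j             _       = refl
    quadruples-vanish ψ₄≡0 (suc k) zero          _       = refl
    quadruples-vanish ψ₄≡0 (suc k) 1             _       = ψ₄≡0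
    quadruples-vanish ψ₄≡0 (suc k) (suc (suc i)) (s≤s b) = trans (v-even k i) (product-vanishes i (half-bound 7 i b))
      where
      vanish : ∀ j → j * 2 * 2 ≤ k → v k (j * 2 * 2) ≡ 0ℚ
      vanish = quadruples-vanish ψ₄≡0 k
      product-vanishes : ∀ i → 7 + i * 2 ≤ k
        → v k (4 + i * 2) ℚ.* (v k (6 + i * 2) ℚ.* v k (3 + i * 2) ² ℚ.- v k (2 + i * 2) ℚ.* v k (5 + i * 2) ²) ≡ 0ℚ
      product-vanishes i b with parityView i
      ... | even l = trans (cong (ℚ._* bracket) (vanish (1 + l) (ℕP.m+n≤o⇒n≤o 3 b))) (ℚP.*-zeroˡ bracket)
        where
        bracket : ℚ
        bracket = v k (6 + i * 2) ℚ.* v k (3 + i * 2) ² ℚ.- v k (2 + i * 2) ℚ.* v k (5 + i * 2) ²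
      ... | odd l = trans (cong₂ (λ p q → v k (4 + i * 2) ℚ.* (p ℚ.* v k (3 + i * 2) ² ℚ.- q ℚ.* v k (5 + i * 2) ²))
                                 (vanish (2 + l) (ℕP.m+n≤o⇒n≤o 1 b)) (vanish (1 + l) (ℕP.m+n≤o⇒n≤o 5 b)))
                          (annihilate (v k (4 + i * 2)) (v k (3 + i * 2) ²) (v k (5 + i * 2) ²))
        where
        annihilate : ∀ u a b → u ℚ.* (0ℚ ℚ.* a ℚ.- 0ℚ ℚ.* b) ≡ 0ℚ
        annihilate = solve-∀ ℚ-ring

    module OddValues (c : ℚ) (ψ₃≈±c : evalP ψ3 x ≈± c)
                     (f²v₄ⱼ≡0 : ∀ k j → j * 2 * 2 ≤ k → f²ₓ ℚ.* v k (j * 2 * 2) ≡ 0ℚ) where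

      f²-kills : ∀ k j → 4 + j * 2 ≤ k → f²ₓ ℚ.* v k (4 + j * 2) ≡ 0ℚ ⊎ f²ₓ ℚ.* v k (2 + j * 2) ≡ 0ℚ
      f²-kills k j b with parityView j
      ... | even i = inj₁ (f²v₄ⱼ≡0 k (1 + i) b)
      ... | odd i  = inj₂ (f²v₄ⱼ≡0 k (1 + i) (ℕP.m+n≤o⇒n≤o 2 b))

      combine : ∀ n a b {w u u′} → n * n + 3 ≡ (1 + a * 2) * (1 + a * 2) + 3 * ((1 + b * 2) * (1 + b * 2))
              → w ≈± u ℚ.* u′ ³ → u ≈± c ^ℚ oddExponent (1 + a * 2) → u′ ≈± c ^ℚ oddExponent (1 + b * 2)
              → w ≈± c ^ℚ oddExponent n
      combine n a b eq w≈±uu′³ u≈± u′≈± = ≈±-trans w≈±uu′³ (≈±-trans (≈±-*-cong u≈± (≈±-³ u′≈±))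
        (inj₁ (trans (sym (^ℚ-+-3* c (oddExponent (1 + a * 2)) (oddExponent (1 + b * 2)))) (cong (c ^ℚ_) (sym (oddExponent-step n a b eq))))))

      odd-values : ∀ k m → 1 + m * 2 ≤ k → v k (1 + m * 2) ≈± c ^ℚ oddExponent (1 + m * 2)
      odd-values (suc k) m (s≤s b) with parityView m
      ... | even zero = inj₁ (one+x*0 x)
        where
        one+x*0 : ∀ x → 1ℚ ℚ.+ x ℚ.* 0ℚ ≡ 1ℚ
        one+x*0 = solve-∀ ℚ-ring
      ... | odd zero = ≈±-trans ψ₃≈±c (inj₁ (sym (ℚP.*-identityʳ c)))
      ... | even (suc j) = combine (1 + (2 + j * 2) * 2) j (1 + j) (squares j)
              (≈±-minus-zeroˡ (v k (1 + j * 2) ℚ.* v k (3 + j * 2) ³) (v-oddᵉ k j)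
                 (*-³-zero f²ₓ (v k (4 + j * 2)) (v k (2 + j * 2)) (f²-kills k j b₄)))
              (odd-values k j (ℕP.m+n≤o⇒n≤o 3 b₄)) (odd-values k (1 + j) (ℕP.m+n≤o⇒n≤o 1 b₄))
        where
        b₄ : 4 + j * 2 ≤ k
        b₄ = half-bound 4 j b
        squares : ∀ j → (1 + (2 + j * 2) * 2) * (1 + (2 + j * 2) * 2) + 3
                      ≡ (1 + j * 2) * (1 + j * 2) + 3 * ((1 + (1 + j) * 2) * (1 + (1 + j) * 2))
        squares = ℕSolver.solve-∀
      ... | odd (suc j) = combine (1 + (3 + j * 2) * 2) (2 + j) (1 + j) (squares j)
              (≈±-minus-zeroʳ (v k (5 + j * 2) ℚ.* v k (3 + j * 2) ³) (v-oddᵒ k j)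
                 (*-³-zero f²ₓ (v k (2 + j * 2)) (v k (4 + j * 2)) (swap (f²-kills k j (ℕP.m+n≤o⇒n≤o 2 b₆)))))
              (odd-values k (2 + j) (ℕP.m+n≤o⇒n≤o 1 b₆)) (odd-values k (1 + j) (ℕP.m+n≤o⇒n≤o 3 b₆))
        where
        b₆ : 6 + j * 2 ≤ k
        b₆ = half-bound 6 j b
        squares : ∀ j → (1 + (3 + j * 2) * 2) * (1 + (3 + j * 2) * 2) + 3
                      ≡ (1 + (2 + j) * 2) * (1 + (2 + j) * 2) + 3 * ((1 + (1 + j) * 2) * (1 + (1 + j) * 2))
        squares = ℕSolver.solve-∀

      Ψ-odd : ∀ n → n % 2 ≡ 1 → evalP (g n n) x ≈± c ^ℚ oddExponent n
      Ψ-odd n n-odd with odd⇒1+m*2 {n} n-odd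
      ... | m , refl = odd-values (1 + m * 2) m ℕP.≤-refl

module ChordTangent (E : Weierstrass ℚ) where
  open Weierstrass E

  chordSum : ℚ → ℚ → ℚ → ℚ → Pt
  chordSum λ′ x₁ x₂ y₁ = pt x₃ (ℚ.- (λ′ ℚ.+ a1) ℚ.* x₃ ℚ.- (y₁ ℚ.- λ′ ℚ.* x₁) ℚ.- a3)
    where
    x₃ : ℚ
    x₃ = λ′ ℚ.* λ′ ℚ.+ a1 ℚ.* λ′ ℚ.- a2 ℚ.- x₁ ℚ.- x₂

  addPt-secant : ∀ {x₁ y₁ x₂ y₂} → x₁ ≢ x₂
    → addPt E (pt x₁ y₁) (pt x₂ y₂) ≡ chordSum ((y₂ ℚ.- y₁) ⊘ (x₂ ℚ.- x₁)) x₁ x₂ y₁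
  addPt-secant {x₁} {_} {x₂} x₁≢x₂ with x₁ ℚ.≟ x₂
  ... | yes x₁≡x₂ = ⊥-elim (x₁≢x₂ x₁≡x₂)
  ... | no _      = refl

  addPt-tangent : ∀ {x y₁ y₂} → y₁ ℚ.+ y₂ ℚ.+ a1 ℚ.* x ℚ.+ a3 ≢ 0ℚ
    → addPt E (pt x y₁) (pt x y₂)
      ≡ chordSum ((ι (+ 3) ℚ.* x ℚ.* x ℚ.+ ι (+ 2) ℚ.* a2 ℚ.* x ℚ.+ a4 ℚ.- a1 ℚ.* y₁)
                  ⊘ (ι (+ 2) ℚ.* y₁ ℚ.+ a1 ℚ.* x ℚ.+ a3)) x x y₁
  addPt-tangent {x} {y₁} {y₂} ≢0 with x ℚ.≟ x
  ... | no x≢x = ⊥-elim (x≢x refl)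
  ... | yes _ with (y₁ ℚ.+ y₂ ℚ.+ a1 ℚ.* x ℚ.+ a3) ℚ.≟ 0ℚ
  ...   | yes ≡0 = ⊥-elim (≢0 ≡0)
  ...   | no _   = refl

  addPt-vertical : ∀ {x y₁ y₂} → y₁ ℚ.+ y₂ ℚ.+ a1 ℚ.* x ℚ.+ a3 ≡ 0ℚ → addPt E (pt x y₁) (pt x y₂) ≡ O
  addPt-vertical {x} {y₁} {y₂} ≡0 with x ℚ.≟ x
  ... | no x≢x = ⊥-elim (x≢x refl)
  ... | yes _ with (y₁ ℚ.+ y₂ ℚ.+ a1 ℚ.* x ℚ.+ a3) ℚ.≟ 0ℚ
  ...   | yes _  = refl
  ...   | no ≢0 = ⊥-elim (≢0 ≡0)

constantTerm : Poly → ℚ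
constantTerm []      = 0ℚ
constantTerm (c ∷ _) = c

evalP-at-0 : ∀ p → evalP p 0ℚ ≡ constantTerm p
evalP-at-0 []      = refl
evalP-at-0 (c ∷ p) = trans (cong (c ℚ.+_) (ℚP.*-zeroˡ (evalP p 0ℚ))) (ℚP.+-identityʳ c)

tateNormal₄ : ℚ → ℚ → Weierstrass ℚ
tateNormal₄ a1 a2 = weierstrass a1 a2 (a1 ℚ.* a2) 0ℚ 0ℚ

module TateNormal₄ (a1 a2 : ℚ) where
  open DivPoly (tateNormal₄ a1 a2) using (f; ψ3; ψ4/ψ2; b2; b4; b6; b8)
  open ChordTangent (tateNormal₄ a1 a2)

  P : Pt
  P = pt 0ℚ 0ℚ

  P-on-curve : OnCurve (tateNormal₄ a1 a2) P
  P-on-curve = identity a1 a2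
    where
    identity : ∀ a1 a2 → 0ℚ ℚ.* 0ℚ ℚ.+ a1 ℚ.* 0ℚ ℚ.* 0ℚ ℚ.+ a1 ℚ.* a2 ℚ.* 0ℚ
                       ≡ 0ℚ ℚ.* 0ℚ ℚ.* 0ℚ ℚ.+ a2 ℚ.* 0ℚ ℚ.* 0ℚ ℚ.+ 0ℚ ℚ.* 0ℚ ℚ.+ 0ℚ
    identity = solve-∀ ℚ-ring

  double-P : a1 ℚ.* a2 ≢ 0ℚ → addPt (tateNormal₄ a1 a2) P P ≡ pt (ℚ.- a2) 0ℚ
  double-P a3≢0 = trans (addPt-tangent {0ℚ} {0ℚ} {0ℚ} (λ e → a3≢0 (trans (sym (denominator a1 a2)) e)))
                    (trans (cong (λ l → chordSum l 0ℚ 0ℚ 0ℚ) (⊘-zeroˡ (ι (+ 2) ℚ.* 0ℚ ℚ.+ a1 ℚ.* 0ℚ ℚ.+ a1 ℚ.* a2) (numerator a1 a2)))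
                           (cong₂ pt (x₃ a1 a2) (y₃ a1 a2)))
    where
    denominator : ∀ a1 a2 → 0ℚ ℚ.+ 0ℚ ℚ.+ a1 ℚ.* 0ℚ ℚ.+ a1 ℚ.* a2 ≡ a1 ℚ.* a2
    denominator = solve-∀ ℚ-ring
    numerator : ∀ a1 a2 → ι (+ 3) ℚ.* 0ℚ ℚ.* 0ℚ ℚ.+ ι (+ 2) ℚ.* a2 ℚ.* 0ℚ ℚ.+ 0ℚ ℚ.- a1 ℚ.* 0ℚ ≡ 0ℚ
    numerator = solve-∀ ℚ-ring
    x₃ : ∀ a1 a2 → 0ℚ ℚ.* 0ℚ ℚ.+ a1 ℚ.* 0ℚ ℚ.- a2 ℚ.- 0ℚ ℚ.- 0ℚ ≡ ℚ.- a2
    x₃ = solve-∀ ℚ-ring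
    y₃ : ∀ a1 a2 → ℚ.- (0ℚ ℚ.+ a1) ℚ.* (0ℚ ℚ.* 0ℚ ℚ.+ a1 ℚ.* 0ℚ ℚ.- a2 ℚ.- 0ℚ ℚ.- 0ℚ)
                   ℚ.- (0ℚ ℚ.- 0ℚ ℚ.* 0ℚ) ℚ.- a1 ℚ.* a2 ≡ 0ℚ
    y₃ = solve-∀ ℚ-ring

  triple-P : a2 ≢ 0ℚ → addPt (tateNormal₄ a1 a2) P (pt (ℚ.- a2) 0ℚ) ≡ pt 0ℚ (ℚ.- (a1 ℚ.* a2))
  triple-P a2≢0 = trans (addPt-secant {0ℚ} {0ℚ} {ℚ.- a2} {0ℚ} 0≢-a2)
                    (trans (cong (λ l → chordSum l 0ℚ (ℚ.- a2) 0ℚ) (⊘-zeroˡ (ℚ.- a2 ℚ.- 0ℚ) refl))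
                           (cong₂ pt (x₃ a1 a2) (y₃ a1 a2)))
    where
    0≢-a2 : 0ℚ ≢ ℚ.- a2
    0≢-a2 e = a2≢0 (trans (sym (neg-involutive a2)) (cong ℚ.-_ (sym e)))
    x₃ : ∀ a1 a2 → 0ℚ ℚ.* 0ℚ ℚ.+ a1 ℚ.* 0ℚ ℚ.- a2 ℚ.- 0ℚ ℚ.- ℚ.- a2 ≡ 0ℚ
    x₃ = solve-∀ ℚ-ring
    y₃ : ∀ a1 a2 → ℚ.- (0ℚ ℚ.+ a1) ℚ.* (0ℚ ℚ.* 0ℚ ℚ.+ a1 ℚ.* 0ℚ ℚ.- a2 ℚ.- 0ℚ ℚ.- ℚ.- a2)
                   ℚ.- (0ℚ ℚ.- 0ℚ ℚ.* 0ℚ) ℚ.- a1 ℚ.* a2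
                 ≡ ℚ.- (a1 ℚ.* a2)
    y₃ = solve-∀ ℚ-ring

  quadruple-P : addPt (tateNormal₄ a1 a2) P (pt 0ℚ (ℚ.- (a1 ℚ.* a2))) ≡ O
  quadruple-P = addPt-vertical {0ℚ} {0ℚ} {ℚ.- (a1 ℚ.* a2)} (vertical a1 a2)
    where
    vertical : ∀ a1 a2 → 0ℚ ℚ.+ ℚ.- (a1 ℚ.* a2) ℚ.+ a1 ℚ.* 0ℚ ℚ.+ a1 ℚ.* a2 ≡ 0ℚ
    vertical = solve-∀ ℚ-ring

  P-order-4 : a2 ≢ 0ℚ → a1 ℚ.* a2 ≢ 0ℚ → HasOrder (tateNormal₄ a1 a2) 4 P
  P-order-4 a2≢0 a1a2≢0 = P-on-curve , 4P≡O , 1≤k<4⇒kP≢O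
    where
    E : Weierstrass ℚ
    E = tateNormal₄ a1 a2
    2P≡ : mulPt E 2 P ≡ pt (ℚ.- a2) 0ℚ
    2P≡ = double-P a1a2≢0
    3P≡ : mulPt E 3 P ≡ pt 0ℚ (ℚ.- (a1 ℚ.* a2))
    3P≡ = trans (cong (addPt E P) 2P≡) (triple-P a2≢0)
    4P≡O : mulPt E 4 P ≡ O
    4P≡O = trans (cong (addPt E P) 3P≡) quadruple-P
    ≡pt⇒≢O : ∀ {Q x y} → Q ≡ pt x y → Q ≢ O
    ≡pt⇒≢O refl ()
    1≤k<4⇒kP≢O : (k : ℕ) → 1 ℕ.≤ k → k ℕ.< 4 → mulPt E k P ≢ O
    1≤k<4⇒kP≢O 1 _ _ ()
    1≤k<4⇒kP≢O 2 _ _ = ≡pt⇒≢O 2P≡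
    1≤k<4⇒kP≢O 3 _ _ = ≡pt⇒≢O 3P≡
    1≤k<4⇒kP≢O (suc (suc (suc (suc _)))) _ (s≤s (s≤s (s≤s (s≤s ()))))

  b4≡ : b4 ≡ a1 ℚ.* (a1 ℚ.* a2)
  b4≡ = unfold a1 a2
    where
    unfold : ∀ a1 a2 → ι (+ 2) ℚ.* 0ℚ ℚ.+ a1 ℚ.* (a1 ℚ.* a2) ≡ a1 ℚ.* (a1 ℚ.* a2)
    unfold = solve-∀ ℚ-ring

  b6≡ : b6 ≡ (a1 ℚ.* a2) ²
  b6≡ = unfold a1 a2
    where
    unfold : ∀ a1 a2 → a1 ℚ.* a2 ℚ.* (a1 ℚ.* a2) ℚ.+ ι (+ 4) ℚ.* 0ℚ ≡ a1 ℚ.* a2 ℚ.* (a1 ℚ.* a2)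
    unfold = solve-∀ ℚ-ring

  b8≡ : b8 ≡ a2 ℚ.* (a1 ℚ.* a2) ²
  b8≡ = unfold a1 a2
    where
    unfold : ∀ a1 a2 → a1 ℚ.* a1 ℚ.* 0ℚ ℚ.+ ι (+ 4) ℚ.* a2 ℚ.* 0ℚ ℚ.- a1 ℚ.* (a1 ℚ.* a2) ℚ.* 0ℚ
                         ℚ.+ a2 ℚ.* (a1 ℚ.* a2) ℚ.* (a1 ℚ.* a2) ℚ.- 0ℚ ℚ.* 0ℚ
                       ≡ a2 ℚ.* (a1 ℚ.* a2 ℚ.* (a1 ℚ.* a2))
    unfold = solve-∀ ℚ-ring

  ψ3-at-0 : evalP ψ3 0ℚ ≡ a2 ℚ.* (a1 ℚ.* a2) ²
  ψ3-at-0 = trans (evalP-at-0 ψ3) b8≡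

  ψ4-at-0 : evalP ψ4/ψ2 0ℚ ≡ 0ℚ
  ψ4-at-0 = begin
    evalP ψ4/ψ2 0ℚ            ≡⟨ evalP-at-0 ψ4/ψ2 ⟩
    b4 ℚ.* b8 ℚ.- b6 ℚ.* b6  ≡⟨ cong₂ ℚ._-_ (cong₂ ℚ._*_ b4≡ b8≡) (cong₂ ℚ._*_ b6≡ b6≡) ⟩
    a1 ℚ.* (a1 ℚ.* a2) ℚ.* (a2 ℚ.* (a1 ℚ.* a2) ²) ℚ.- (a1 ℚ.* a2) ² ℚ.* (a1 ℚ.* a2) ²  ≡⟨ cancel a1 a2 ⟩
    0ℚ                        ∎
    where
    open ≡-Reasoning
    cancel : ∀ a1 a2 → a1 ℚ.* (a1 ℚ.* a2) ℚ.* (a2 ℚ.* (a1 ℚ.* a2 ℚ.* (a1 ℚ.* a2)))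
                       ℚ.- a1 ℚ.* a2 ℚ.* (a1 ℚ.* a2) ℚ.* (a1 ℚ.* a2 ℚ.* (a1 ℚ.* a2)) ≡ 0ℚ
    cancel = solve-∀ ℚ-ring

  -- The next two statements are the Horner forms of the values, with b2, b4, b6, b8 unfolded;
  -- the first is (a3 - a1a2)².
  f-at-−a2 : evalP f (ℚ.- a2) ≡ 0ℚ
  f-at-−a2 = horner a1 a2
    where
    horner : ∀ a1 a2 → a1 ℚ.* a2 ℚ.* (a1 ℚ.* a2) ℚ.+ ι (+ 4) ℚ.* 0ℚ
                       ℚ.+ ℚ.- a2 ℚ.* (ι (+ 2) ℚ.* (ι (+ 2) ℚ.* 0ℚ ℚ.+ a1 ℚ.* (a1 ℚ.* a2))
                       ℚ.+ ℚ.- a2 ℚ.* (a1 ℚ.* a1 ℚ.+ ι (+ 4) ℚ.* a2 ℚ.+ ℚ.- a2 ℚ.* (ι (+ 4) ℚ.+ ℚ.- a2 ℚ.* 0ℚ))) ≡ 0ℚ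
    horner = solve-∀ ℚ-ring

  ψ3-at-−a2 : evalP ψ3 (ℚ.- a2) ≡ ℚ.- (a2 ² ℚ.* a2 ²)
  ψ3-at-−a2 = horner a1 a2
    where
    horner : ∀ a1 a2 → a1 ℚ.* a1 ℚ.* 0ℚ ℚ.+ ι (+ 4) ℚ.* a2 ℚ.* 0ℚ ℚ.- a1 ℚ.* (a1 ℚ.* a2) ℚ.* 0ℚ
                         ℚ.+ a2 ℚ.* (a1 ℚ.* a2) ℚ.* (a1 ℚ.* a2) ℚ.- 0ℚ ℚ.* 0ℚ
                       ℚ.+ ℚ.- a2 ℚ.* (ι (+ 3) ℚ.* (a1 ℚ.* a2 ℚ.* (a1 ℚ.* a2) ℚ.+ ι (+ 4) ℚ.* 0ℚ)
                       ℚ.+ ℚ.- a2 ℚ.* (ι (+ 3) ℚ.* (ι (+ 2) ℚ.* 0ℚ ℚ.+ a1 ℚ.* (a1 ℚ.* a2))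
                       ℚ.+ ℚ.- a2 ℚ.* (a1 ℚ.* a1 ℚ.+ ι (+ 4) ℚ.* a2 ℚ.+ ℚ.- a2 ℚ.* (ι (+ 3) ℚ.+ ℚ.- a2 ℚ.* 0ℚ))))
                     ≡ ℚ.- (a2 ℚ.* a2 ℚ.* (a2 ℚ.* a2))
    horner = solve-∀ ℚ-ring

  open DivisionValues (tateNormal₄ a1 a2) using (module AtPoint)

  Ψ-at-0 : ∀ n → n % 2 ≡ 1 → evalP (DivPoly.Ψ (tateNormal₄ a1 a2) n) 0ℚ ≈± (a2 ℚ.* (a1 ℚ.* a2) ²) ^ℚ oddExponent n
  Ψ-at-0 = OddValues.Ψ-odd (a2 ℚ.* (a1 ℚ.* a2) ²) (inj₁ ψ3-at-0) f²v₄ⱼ≡0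
    where
    open AtPoint 0ℚ
    f²v₄ⱼ≡0 : ∀ k j → j * 2 * 2 ≤ k → f²ₓ ℚ.* v k (j * 2 * 2) ≡ 0ℚ
    f²v₄ⱼ≡0 k j b = trans (cong (f²ₓ ℚ.*_) (quadruples-vanish ψ4-at-0 k j b)) (ℚP.*-zeroʳ f²ₓ)

  Ψ-at-−a2 : ∀ n → n % 2 ≡ 1 → evalP (DivPoly.Ψ (tateNormal₄ a1 a2) n) (ℚ.- a2) ≈± (a2 ² ℚ.* a2 ²) ^ℚ oddExponent n
  Ψ-at-−a2 = OddValues.Ψ-odd (a2 ² ℚ.* a2 ²) (inj₂ ψ3-at-−a2) f²v≡0
    where
    open AtPoint (ℚ.- a2)
    f²ₓ≡0 : f²ₓ ≡ 0ℚ
    f²ₓ≡0 = trans (evalP-⊗ f f (ℚ.- a2)) (trans (cong (ℚ._* evalP f (ℚ.- a2)) f-at-−a2) (ℚP.*-zeroˡ (evalP f (ℚ.- a2))))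
    f²v≡0 : ∀ k j → j * 2 * 2 ≤ k → f²ₓ ℚ.* v k (j * 2 * 2) ≡ 0ℚ
    f²v≡0 k j _ = trans (cong (ℚ._* v k (j * 2 * 2)) f²ₓ≡0) (ℚP.*-zeroˡ (v k (j * 2 * 2)))

-- `fueterSum` is the local function `hom` of `F`; the meta is solved by unifying with the body of `F`.
mutual
  fueterSum : ℤ → ℤ → ℕ → ℚ → ℕ → Poly → ℚ
  fueterSum = _

  F-unfold : ∀ α β n t → F α β n t ≡ fueterSum α β n t 0 (DivPoly.Ψ (E-ℚ α β) n) ⊘ Ψ α β n (ℚ.- ι (aOf α β ℤ.* β))
  F-unfold α β n t with Ψ α β n (ℚ.- ι (aOf α β ℤ.* β)) | DivPoly.Ψ (E-ℚ α β) n
  ... | _ | _ with 0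
  ...   | _ = refl

1^ℚ : ∀ m → 1ℚ ^ℚ m ≡ 1ℚ
1^ℚ zero    = refl
1^ℚ (suc m) = trans (ℚP.*-identityˡ (1ℚ ^ℚ m)) (1^ℚ m)

-- Every term of index k ≥ 1 in `fueterSum` at T = 1 carries the factor (1 - T)ᵏ = 0.
fueterSum-at-1-tail : ∀ α β n k cs → fueterSum α β n 1ℚ (suc k) cs ≡ 0ℚ
fueterSum-at-1-tail α β n k []       = refl
fueterSum-at-1-tail α β n k (c ∷ cs) =
  trans (cong₂ ℚ._+_ (vanishing c (ι (aOf α β ℤ.* β) ^ℚ suc k) ((1ℚ ℚ.- 1ℚ) ^ℚ k) (1ℚ ^ℚ ((n ℕ.* n ∸ 1) / 2 ∸ suc k)))
                     (fueterSum-at-1-tail α β n (suc k) cs))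
        (ℚP.+-identityʳ 0ℚ)
  where
  vanishing : ∀ c s z u → c ℚ.* s ℚ.* ((1ℚ ℚ.- 1ℚ) ℚ.* z) ℚ.* u ≡ 0ℚ
  vanishing = solve-∀ ℚ-ring

fueterSum-at-1 : ∀ α β n L → fueterSum α β n 1ℚ 0 L ≡ evalP L 0ℚ
fueterSum-at-1 α β n []       = refl
fueterSum-at-1 α β n (c ∷ cs) = begin
  c ℚ.* 1ℚ ℚ.* 1ℚ ℚ.* 1ℚ ^ℚ ((n ℕ.* n ∸ 1) / 2) ℚ.+ fueterSum α β n 1ℚ 1 cs
    ≡⟨ cong₂ (λ u w → c ℚ.* 1ℚ ℚ.* 1ℚ ℚ.* u ℚ.+ w) (1^ℚ ((n ℕ.* n ∸ 1) / 2)) (fueterSum-at-1-tail α β n 0 cs) ⟩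
  c ℚ.* 1ℚ ℚ.* 1ℚ ℚ.* 1ℚ ℚ.+ 0ℚ
    ≡⟨ simplify c ⟩
  c
    ≡⟨ sym (evalP-at-0 (c ∷ cs)) ⟩
  evalP (c ∷ cs) 0ℚ ∎
  where
  open ≡-Reasoning
  simplify : ∀ c → c ℚ.* 1ℚ ℚ.* 1ℚ ℚ.* 1ℚ ℚ.+ 0ℚ ≡ c
  simplify = solve-∀ ℚ-ring

F-at-1 : ∀ α β n → F α β n 1ℚ ≡ Ψ α β n 0ℚ ⊘ Ψ α β n (ℚ.- ι (aOf α β ℤ.* β))
F-at-1 α β n = trans (F-unfold α β n 1ℚ)
                     (cong (_⊘ Ψ α β n (ℚ.- ι (aOf α β ℤ.* β))) (fueterSum-at-1 α β n (DivPoly.Ψ (E-ℚ α β) n)))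

∣^∣ : ∀ z t → ℤ.∣ z ℤ.^ t ∣ ≡ ℤ.∣ z ∣ ^ t
∣^∣ z zero    = refl
∣^∣ z (suc t) = trans (ℤP.abs-* z (z ℤ.^ t)) (cong (ℤ.∣ z ∣ *_) (∣^∣ z t))

cross-multiply : ∀ q d n → q ℚ.* ι d ≡ ι n → ℤ.∣ ℚ.↥ q ∣ * ℤ.∣ d ∣ ≡ ℤ.∣ n ∣ * ℚ.↧ₙ q
cross-multiply q@(mkℚ N D _) d n eq with toℚᵘ-eq
  where
  toℚᵘ-eq : ℚᵘ.mkℚᵘ N D ℚᵘ.* ℚᵘ.mkℚᵘ d 0 ℚᵘ.≃ ℚᵘ.mkℚᵘ n 0
  toℚᵘ-eq = ℚᵘP.≃-trans (ℚᵘP.*-cong (ℚᵘP.≃-refl {ℚᵘ.mkℚᵘ N D}) (ℚᵘP.≃-sym (ℚP.toℚᵘ-fromℚᵘ (ℚᵘ.mkℚᵘ d 0))))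
            (ℚᵘP.≃-trans (ℚᵘP.≃-sym (ℚP.toℚᵘ-homo-* q (ι d)))
            (ℚᵘP.≃-trans (ℚP.toℚᵘ-cong eq) (ℚP.toℚᵘ-fromℚᵘ (ℚᵘ.mkℚᵘ n 0))))
... | ℚᵘ.*≡* N*d*1≡n*D = begin
  ℤ.∣ N ∣ * ℤ.∣ d ∣              ≡⟨ sym (ℤP.abs-* N d) ⟩
  ℤ.∣ N ℤ.* d ∣                  ≡⟨ cong ℤ.∣_∣ (sym (ℤP.*-identityʳ (N ℤ.* d))) ⟩
  ℤ.∣ N ℤ.* d ℤ.* + 1 ∣          ≡⟨ cong ℤ.∣_∣ N*d*1≡n*D ⟩
  ℤ.∣ n ℤ.* + suc (D * 1) ∣      ≡⟨ ℤP.abs-* n (+ suc (D * 1)) ⟩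
  ℤ.∣ n ∣ * suc (D * 1)          ≡⟨ cong (λ t → ℤ.∣ n ∣ * suc t) (ℕP.*-identityʳ D) ⟩
  ℤ.∣ n ∣ * suc D                ∎
  where open ≡-Reasoning

module Valuation (p : ℕ) (p-prime : Prime p) where
  open import Data.Nat.Divisibility using (_∣_; divides; ∣-trans; _∣0; 1∣_; ∣1⇒≡1; m∣m*n; n∣m*n; *-cancelˡ-∣; *-monoʳ-∣)

  instance
    p≢0 : NonZero p
    p≢0 = prime⇒nonZero p-prime

  p^k≢0 : ∀ k → NonZero (p ^ k)
  p^k≢0 k = ℕP.m^n≢0 p k

  p∤1 : ¬ p ∣ 1
  p∤1 p∣1 = ℕ.nonTrivial⇒≢1 {{prime⇒nonTrivial p-prime}} (∣1⇒≡1 p∣1)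

  infix 4 p^_∥_
  record p^_∥_ (k N : ℕ) : Set where
    constructor exact
    field
      cofactor   : ℕ
      factorise  : N ≡ p ^ k * cofactor
      p∤cofactor : ¬ p ∣ cofactor

  ∥-unit : ∀ {N} → ¬ p ∣ N → p^ 0 ∥ N
  ∥-unit {N} p∤N = exact N (sym (ℕP.*-identityˡ N)) p∤N

  ∥-* : ∀ {x y i j} → p^ i ∥ x → p^ j ∥ y → p^ (i + j) ∥ x * y
  ∥-* {i = i} {j} (exact u refl p∤u) (exact w refl p∤w) =
    exact (u * w) (trans (interchange (p ^ i) (p ^ j) u w) (cong (_* (u * w)) (sym (ℕP.^-distribˡ-+-* p i j))))
          (λ p∣uw → [ p∤u , p∤w ] (euclidsLemma u w p-prime p∣uw))
    where
    interchange : ∀ a b u w → a * u * (b * w) ≡ a * b * (u * w)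
    interchange = ℕSolver.solve-∀

  ∥-^ : ∀ {x i} → p^ i ∥ x → ∀ t → p^ (t * i) ∥ x ^ t
  ∥-^ _   zero    = ∥-unit p∤1
  ∥-^ x∥ (suc t) = ∥-* x∥ (∥-^ x∥ t)

  ∥-ℤ* : ∀ x y {i j} → p^ i ∥ ℤ.∣ x ∣ → p^ j ∥ ℤ.∣ y ∣ → p^ (i + j) ∥ ℤ.∣ x ℤ.* y ∣
  ∥-ℤ* x y x∥ y∥ = subst (p^ _ ∥_) (sym (ℤP.abs-* x y)) (∥-* x∥ y∥)

  ∥-ℤ^ : ∀ x {i} → p^ i ∥ ℤ.∣ x ∣ → ∀ t → p^ (t * i) ∥ ℤ.∣ x ℤ.^ t ∣
  ∥-ℤ^ x x∥ t = subst (p^ _ ∥_) (sym (∣^∣ x t)) (∥-^ x∥ t)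

  ValZ⇒∥ : ∀ {z k} → ValZ p z k → p^ k ∥ ℤ.∣ z ∣
  ValZ⇒∥ {k = k} (_ , divides u eq , p^1+k∤z) = exact u (trans eq (ℕP.*-comm u (p ^ k))) p∤u
    where
    p∤u : ¬ p ∣ u
    p∤u p∣u = p^1+k∤z (subst₂ _∣_ (ℕP.*-comm (p ^ k) p) (trans (ℕP.*-comm (p ^ k) u) (sym eq)) (*-monoʳ-∣ (p ^ k) p∣u))

  ∥⇒ValZ : ∀ {z k} → p^ k ∥ ℤ.∣ z ∣ → ValZ p z k
  ∥⇒ValZ {z} {k} (exact u eq p∤u) = z≢0 , divides u (trans eq (ℕP.*-comm (p ^ k) u)) , p^1+k∤z
    where
    z≢0 : z ≢ + 0
    z≢0 refl with ℕP.m*n≡0⇒m≡0∨n≡0 (p ^ k) (sym eq)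
    ... | inj₁ p^k≡0 = ℕ.≢-nonZero⁻¹ (p ^ k) {{p^k≢0 k}} p^k≡0
    ... | inj₂ refl  = p∤u (p ∣0)
    p^1+k∤z : ¬ p ^ suc k ∣ ℤ.∣ z ∣
    p^1+k∤z d = p∤u (*-cancelˡ-∣ (p ^ k) {{p^k≢0 k}} (subst₂ _∣_ (ℕP.*-comm p (p ^ k)) eq d))

  p^b∣u*y⇒p^b∣y : ∀ b {u y} → ¬ p ∣ u → p ^ b ∣ u * y → p ^ b ∣ y
  p^b∣u*y⇒p^b∣y zero    _   _ = 1∣ _
  p^b∣u*y⇒p^b∣y (suc b) {u} {y} p∤u p^1+b∣uy with euclidsLemma u y p-prime (∣-trans (m∣m*n (p ^ b)) p^1+b∣uy)
  ... | inj₁ p∣u = ⊥-elim (p∤u p∣u)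
  ... | inj₂ (divides y′ refl) = subst (p * p ^ b ∣_) (ℕP.*-comm p y′) (*-monoʳ-∣ p p^b∣y′)
    where
    regroup : ∀ u y′ p → u * (y′ * p) ≡ p * (u * y′)
    regroup = ℕSolver.solve-∀
    p^b∣y′ : p ^ b ∣ y′
    p^b∣y′ = p^b∣u*y⇒p^b∣y b p∤u (*-cancelˡ-∣ p (subst (p * p ^ b ∣_) (regroup u y′ p) p^1+b∣uy))

  ∥0⇒∤ : ∀ {N} → p^ 0 ∥ N → ¬ p ∣ N
  ∥0⇒∤ (exact u N≡1*u p∤u) p∣N = p∤u (subst (p ∣_) (trans N≡1*u (ℕP.*-identityˡ u)) p∣N)

  coprime-cross : ∀ {X Y u d b} → Coprime X Y → X * d ≡ u * Y → ¬ p ∣ u → p^ b ∥ d → ¬ p ∣ X × p^ b ∥ Y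
  coprime-cross {X} {Y} {u} {b = b} X⊥Y eq p∤u (exact v refl p∤v) = p∤X , Y-exact p^b∣Y
    where
    regroup : ∀ X a v → X * (a * v) ≡ a * (X * v)
    regroup = ℕSolver.solve-∀
    p∤X : ¬ p ∣ X
    p∤X p∣X with euclidsLemma u Y p-prime (subst (p ∣_) eq (∣-trans p∣X (m∣m*n (p ^ b * v))))
    ... | inj₁ p∣u = p∤u p∣u
    ... | inj₂ p∣Y = ℕ.nonTrivial⇒≢1 {{prime⇒nonTrivial p-prime}} (X⊥Y (p∣X , p∣Y))
    p^b∣Y : p ^ b ∣ Y
    p^b∣Y = p^b∣u*y⇒p^b∣y b p∤u (subst (p ^ b ∣_) (trans (sym (regroup X (p ^ b) v)) eq) (m∣m*n (X * v)))
    Y-exact : p ^ b ∣ Y → p^ b ∥ Y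
    Y-exact (divides y Y≡y*p^b) = exact y (trans Y≡y*p^b (ℕP.*-comm y (p ^ b))) p∤y
      where
      Xv≡uy : X * v ≡ u * y
      Xv≡uy = ℕP.*-cancelˡ-≡ (X * v) (u * y) (p ^ b) {{p^k≢0 b}} (begin
        p ^ b * (X * v)  ≡⟨ sym (regroup X (p ^ b) v) ⟩
        X * (p ^ b * v)  ≡⟨ eq ⟩
        u * Y            ≡⟨ cong (u *_) (trans Y≡y*p^b (ℕP.*-comm y (p ^ b))) ⟩
        u * (p ^ b * y)  ≡⟨ regroup u (p ^ b) y ⟩
        p ^ b * (u * y)  ∎)
        where open ≡-Reasoning
      p∤y : ¬ p ∣ y
      p∤y p∣y = [ p∤X , p∤v ] (euclidsLemma X v p-prime (subst (p ∣_) (sym Xv≡uy) (∣-trans p∣y (n∣m*n u))))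

  ValQ-cross : ∀ q d n {a b k} → q ℚ.* ι d ≡ ι n → p^ a ∥ ℤ.∣ n ∣ → p^ b ∥ ℤ.∣ d ∣ → a ≡ 0 ⊎ b ≡ 0
             → k ≡ + a ℤ.- + b → ValQ p q k
  ValQ-cross q@(mkℚ _ _ N⊥D) d n {b = b} eq n∥ d∥ (inj₁ refl) k≡ =
    0 , b , ∥⇒ValZ (∥-unit (proj₁ cross)) , ∥⇒ValZ (proj₂ cross) , k≡
    where
    cross : ¬ p ∣ ℤ.∣ ℚ.↥ q ∣ × p^ b ∥ ℚ.↧ₙ q
    cross = coprime-cross (Coprimality.recompute N⊥D) (cross-multiply q d n eq) (∥0⇒∤ n∥) d∥
  ValQ-cross q@(mkℚ _ _ N⊥D) d n {a = a} eq n∥ d∥ (inj₂ refl) k≡ =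
    a , 0 , ∥⇒ValZ (proj₂ cross) , ∥⇒ValZ (∥-unit (proj₁ cross)) , k≡
    where
    cross : ¬ p ∣ ℚ.↧ₙ q × p^ a ∥ ℤ.∣ ℚ.↥ q ∣
    cross = coprime-cross (Coprimality.sym (Coprimality.recompute N⊥D))
              (trans (ℕP.*-comm (ℚ.↧ₙ q) ℤ.∣ n ∣) (sym (trans (ℕP.*-comm ℤ.∣ d ∣ _) (cross-multiply q d n eq)))) (∥0⇒∤ d∥) n∥

  ValZ-abs : ∀ {z z′ k} → ℤ.∣ z ∣ ≡ ℤ.∣ z′ ∣ → ValZ p z k → ValZ p z′ k
  ValZ-abs {z} {z′} {k} eq v = ∥⇒ValZ {z′} (subst (p^ k ∥_) eq (ValZ⇒∥ {z} v))

  ValQ-neg : ∀ {q k} → ValQ p q k → ValQ p (ℚ.- q) k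
  ValQ-neg {q} (a , b , ↥q-val , ↧q-val , k≡) =
    a , b , ValZ-abs {ℚ.↥ q} {ℚ.↥ (ℚ.- q)} {a} (sym (trans (cong ℤ.∣_∣ (ℚP.↥-neg q)) (ℤP.∣-i∣≡∣i∣ (ℚ.↥ q)))) ↥q-val ,
    subst (λ z → ValZ p z b) (sym (ℚP.↧-neg q)) ↧q-val , k≡

  ValQ-cross± : ∀ q d n {a b k} → q ℚ.* ι d ≈± ι n → p^ a ∥ ℤ.∣ n ∣ → p^ b ∥ ℤ.∣ d ∣ → a ≡ 0 ⊎ b ≡ 0
              → k ≡ + a ℤ.- + b → ValQ p q k
  ValQ-cross± q d n (inj₁ eq) = ValQ-cross q d n eq
  ValQ-cross± q d n {k = k} (inj₂ eq) n∥ d∥ a≡0⊎b≡0 k≡ =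
    subst (λ r → ValQ p r k) (neg-involutive q) (ValQ-neg {ℚ.- q} (ValQ-cross (ℚ.- q) d n -q*d≡n n∥ d∥ a≡0⊎b≡0 k≡))
    where
    -q*d≡n : ℚ.- q ℚ.* ι d ≡ ι n
    -q*d≡n = trans (sym (ℚP.neg-distribˡ-* q (ι d))) (trans (cong ℚ.-_ eq) (neg-involutive (ι n)))

open import Data.Integer.Divisibility using (_∣_)

module CurveE (α β : ℤ) (β≢0 : β ≢ + 0) (a≢0 : aOf α β ≢ + 0) where
  a : ℤ
  a = aOf α β

  A B : ℚ
  A = ι a
  B = ι β

  βa≢0 : β ℤ.* a ≢ + 0
  βa≢0 = *-≢0 β≢0 a≢0

  E-ℚ≡tateNormal₄ : E-ℚ α β ≡ tateNormal₄ A (B ℚ.* A)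
  E-ℚ≡tateNormal₄ = cong₂ (λ a2 a3 → weierstrass A a2 a3 0ℚ 0ℚ) (ι-* β a)
    (trans (ι-* (β ℤ.* a) a) (trans (cong (ℚ._* A) (ι-* β a)) (ℚP.*-comm (B ℚ.* A) A)))

  Ψ≡ : ∀ n x → Ψ α β n x ≡ evalP (DivPoly.Ψ (tateNormal₄ A (B ℚ.* A)) n) x
  Ψ≡ n x = cong (λ E → evalP (DivPoly.Ψ E n) x) E-ℚ≡tateNormal₄

  -- Ψₙ(0) ≈± (aY)ᵉ and Ψₙ(-aβ) ≈± (βY)ᵉ with Y = β³a⁴, so that Fₙ(1) ≈± (a/β)ᵉ.
  y : ℤ
  y = β ℤ.^ 3 ℤ.* a ℤ.^ 4

  y≢0 : y ≢ + 0
  y≢0 = *-≢0 (^-≢0 3 β≢0) (^-≢0 4 a≢0)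

  Y : ℚ
  Y = ι y

  Y≡ : Y ≡ B ℚ.* (B ℚ.* (B ℚ.* 1ℚ)) ℚ.* (A ℚ.* (A ℚ.* (A ℚ.* (A ℚ.* 1ℚ))))
  Y≡ = trans (ι-* (β ℤ.^ 3) (a ℤ.^ 4)) (cong₂ ℚ._*_ (ι-^ β 3) (ι-^ a 4))

  Ψ-at-0 : ∀ n → n % 2 ≡ 1 → Ψ α β n 0ℚ ≈± (A ℚ.* Y) ^ℚ oddExponent n
  Ψ-at-0 n n-odd = subst₂ _≈±_ (sym (Ψ≡ n 0ℚ)) (cong (_^ℚ oddExponent n) (trans (regroup A B) (cong (A ℚ.*_) (sym Y≡))))
                     (TateNormal₄.Ψ-at-0 A (B ℚ.* A) n n-odd)
    where
    regroup : ∀ A B → B ℚ.* A ℚ.* (A ℚ.* (B ℚ.* A) ℚ.* (A ℚ.* (B ℚ.* A)))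
                    ≡ A ℚ.* (B ℚ.* (B ℚ.* (B ℚ.* 1ℚ)) ℚ.* (A ℚ.* (A ℚ.* (A ℚ.* (A ℚ.* 1ℚ)))))
    regroup = solve-∀ ℚ-ring

  Ψ-at-−aβ : ∀ n → n % 2 ≡ 1 → Ψ α β n (ℚ.- ι (a ℤ.* β)) ≈± (B ℚ.* Y) ^ℚ oddExponent n
  Ψ-at-−aβ n n-odd = subst₂ _≈±_ (sym (trans (Ψ≡ n _) (cong (λ x → evalP (DivPoly.Ψ (tateNormal₄ A (B ℚ.* A)) n) (ℚ.- x)) ι[aβ]≡BA)))
                                 (cong (_^ℚ oddExponent n) (trans (regroup A B) (cong (B ℚ.*_) (sym Y≡))))
                       (TateNormal₄.Ψ-at-−a2 A (B ℚ.* A) n n-odd)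
    where
    ι[aβ]≡BA : ι (a ℤ.* β) ≡ B ℚ.* A
    ι[aβ]≡BA = trans (ι-* a β) (ℚP.*-comm A B)
    regroup : ∀ A B → B ℚ.* A ℚ.* (B ℚ.* A) ℚ.* (B ℚ.* A ℚ.* (B ℚ.* A))
                    ≡ B ℚ.* (B ℚ.* (B ℚ.* (B ℚ.* 1ℚ)) ℚ.* (A ℚ.* (A ℚ.* (A ℚ.* (A ℚ.* 1ℚ)))))
    regroup = solve-∀ ℚ-ring

  F-at-1-≈± : ∀ n → n % 2 ≡ 1 → F α β n 1ℚ ℚ.* ι (β ℤ.^ oddExponent n) ≈± ι (a ℤ.^ oddExponent n)
  F-at-1-≈± n n-odd = subst₂ _≈±_ (cong₂ ℚ._*_ (sym (F-at-1 α β n)) (sym (ι-^ β e))) (sym (ι-^ a e))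
    (quotient-≈± (A ^ℚ e) (B ^ℚ e) (Y ^ℚ e) (≈±-≢0 V≈± (subst (λ q → q ^ℚ e ≢ 0ℚ) (ι-* β y) (ι^-≢0 e (*-≢0 β≢0 y≢0))))
                 (ι^-≢0 e y≢0)
                 (≈±-trans (Ψ-at-0 n n-odd) (inj₁ (^ℚ-distrib-* A Y e)))
                 (≈±-trans V≈± (inj₁ (^ℚ-distrib-* B Y e))))
    where
    e : ℕ
    e = oddExponent n
    V≈± : Ψ α β n (ℚ.- ι (a ℤ.* β)) ≈± (B ℚ.* Y) ^ℚ e
    V≈± = Ψ-at-−aβ n n-odd

  BA≢0 : B ℚ.* A ≢ 0ℚ
  BA≢0 = subst (_≢ 0ℚ) (ι-* β a) (ι-≢0 βa≢0)

  A·BA≢0 : A ℚ.* (B ℚ.* A) ≢ 0ℚ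
  A·BA≢0 = subst (_≢ 0ℚ) (trans (ι-* a (β ℤ.* a)) (cong (A ℚ.*_) (ι-* β a))) (ι-≢0 (*-≢0 a≢0 βa≢0))

  order-4 : HasOrder (E-ℚ α β) 4 (pt 0ℚ 0ℚ)
  order-4 = subst (λ E → HasOrder E 4 (pt 0ℚ 0ℚ)) (sym E-ℚ≡tateNormal₄) (TateNormal₄.P-order-4 A (B ℚ.* A) BA≢0 A·BA≢0)

  module AtPrime (p : ℕ) (p-prime : Prime p) where
    open Valuation p p-prime

    Ψ-at-0-val : ∀ n {i j} → n % 2 ≡ 1 → p^ i ∥ ℤ.∣ a ∣ → p^ j ∥ ℤ.∣ β ∣
               → ValQ p (Ψ α β n 0ℚ) (+ (oddExponent n * (i + (3 * j + 4 * i))))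
    Ψ-at-0-val n n-odd a∥ β∥ =
      ValQ-cross± (Ψ α β n 0ℚ) (+ 1) ((a ℤ.* y) ℤ.^ oddExponent n) W*1≈±
        (∥-ℤ^ (a ℤ.* y) (∥-ℤ* a y a∥ (∥-ℤ* (β ℤ.^ 3) (a ℤ.^ 4) (∥-ℤ^ β β∥ 3) (∥-ℤ^ a a∥ 4))) (oddExponent n))
        (∥-unit p∤1) (inj₂ refl) (sym (ℤP.+-identityʳ _))
      where
      W*1≈± : Ψ α β n 0ℚ ℚ.* 1ℚ ≈± ι ((a ℤ.* y) ℤ.^ oddExponent n)
      W*1≈± = subst₂ _≈±_ (sym (ℚP.*-identityʳ _))
                (trans (cong (_^ℚ oddExponent n) (sym (ι-* a y))) (sym (ι-^ (a ℤ.* y) (oddExponent n))))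
                (Ψ-at-0 n n-odd)

    F-at-1-val : ∀ n {i j} → n % 2 ≡ 1 → p^ i ∥ ℤ.∣ a ∣ → p^ j ∥ ℤ.∣ β ∣ → i ≡ 0 ⊎ j ≡ 0
               → ValQ p (F α β n 1ℚ) (+ (oddExponent n * i) ℤ.- + (oddExponent n * j))
    F-at-1-val n n-odd a∥ β∥ i≡0⊎j≡0 =
      ValQ-cross± (F α β n 1ℚ) (β ℤ.^ oddExponent n) (a ℤ.^ oddExponent n) (F-at-1-≈± n n-odd)
        (∥-ℤ^ a a∥ (oddExponent n)) (∥-ℤ^ β β∥ (oddExponent n)) (⊎-map e*0 e*0 i≡0⊎j≡0) refl
      where
      e*0 : ∀ {i} → i ≡ 0 → oddExponent n * i ≡ 0
      e*0 refl = ℕP.*-zeroʳ (oddExponent n)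

    valuations-if-p∣β : ∀ n → n % 2 ≡ 1 → ¬ (+ p) ∣ a → ∀ e → ValZ p β e
      → ValQ p (Ψ α β n 0ℚ) (+ ((3 * n * n ∸ 3) / 8 * e)) × ValQ p (F α β n 1ℚ) (- (+ ((n * n ∸ 1) / 8 * e)))
    valuations-if-p∣β n n-odd p∤a e β-val =
      subst (ValQ p (Ψ α β n 0ℚ)) (cong +_ Ψ-exponent) (Ψ-at-0-val n n-odd (∥-unit p∤a) (ValZ⇒∥ {β} {e} β-val)) ,
      subst (ValQ p (F α β n 1ℚ)) F-exponent (F-at-1-val n n-odd (∥-unit p∤a) (ValZ⇒∥ {β} {e} β-val) (inj₁ refl))
      where
      t : ℕ
      t = oddExponent n
      regroup : ∀ t e → t * (0 + (3 * e + 4 * 0)) ≡ 3 * t * e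
      regroup = ℕSolver.solve-∀
      Ψ-exponent : t * (0 + (3 * e + 4 * 0)) ≡ (3 * n * n ∸ 3) / 8 * e
      Ψ-exponent = trans (regroup t e) (cong (_* e) (sym (scaled-oddExponent 3 {n} n-odd)))
      F-exponent : + (t * 0) ℤ.- + (t * e) ≡ - (+ (t * e))
      F-exponent = trans (cong (λ u → + u ℤ.- + (t * e)) (ℕP.*-zeroʳ t)) (ℤP.+-identityˡ (- (+ (t * e))))

    valuations-if-p∣a : ∀ n → n % 2 ≡ 1 → ¬ (+ p) ∣ β → ∀ e → ValZ p a e
      → ValQ p (Ψ α β n 0ℚ) (+ ((5 * n * n ∸ 5) / 8 * e)) × ValQ p (F α β n 1ℚ) (+ ((n * n ∸ 1) / 8 * e))
    valuations-if-p∣a n n-odd p∤β e a-val =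
      subst (ValQ p (Ψ α β n 0ℚ)) (cong +_ Ψ-exponent) (Ψ-at-0-val n n-odd (ValZ⇒∥ {a} {e} a-val) (∥-unit p∤β)) ,
      subst (ValQ p (F α β n 1ℚ)) F-exponent (F-at-1-val n n-odd (ValZ⇒∥ {a} {e} a-val) (∥-unit p∤β) (inj₂ refl))
      where
      t : ℕ
      t = oddExponent n
      regroup : ∀ t e → t * (e + (3 * 0 + 4 * e)) ≡ 5 * t * e
      regroup = ℕSolver.solve-∀
      Ψ-exponent : t * (e + (3 * 0 + 4 * e)) ≡ (5 * n * n ∸ 5) / 8 * e
      Ψ-exponent = trans (regroup t e) (cong (_* e) (sym (scaled-oddExponent 5 {n} n-odd)))
      F-exponent : + (t * e) ℤ.- + (t * 0) ≡ + (t * e)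
      F-exponent = trans (cong (λ u → + (t * e) ℤ.- + u) (ℕP.*-zeroʳ t)) (ℤP.+-identityʳ (+ (t * e)))

divides-both-impossible : ∀ α β {p} → Coprime ℤ.∣ α ∣ ℤ.∣ β ∣ → Prime p → ¬ ((+ p) ∣ β × (+ p) ∣ (α ℤ.+ (+ 8) ℤ.* β))
divides-both-impossible α β {p} α⊥β p-prime (p∣β , p∣a) = ℕ.nonTrivial⇒≢1 {{prime⇒nonTrivial p-prime}} (α⊥β (p∣α , p∣β))
  where
  p∣α : (+ p) ∣ α
  p∣α = ℤDS.∣⇒∣ᵤ (ℤDS.∣m+n∣n⇒∣m {+ p} {α} (ℤDS.∣ᵤ⇒∣ p∣a) (ℤDS.∣n⇒∣m*n {+ p} (+ 8) {β} (ℤDS.∣ᵤ⇒∣ p∣β)))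

-- At (0, 0) only the term a3 = βa² of the y-derivative survives.
origin-singular : ∀ α β {p} → (+ p) ∣ β ⊎ (+ p) ∣ aOf α β → SingularReduction p (E-ℤ α β) (+ 0) (+ 0)
origin-singular α β {p} p∣β⊎p∣a =
  subst ((+ p) ∣_) (sym (equation a (β ℤ.* a) (β ℤ.* a ℤ.* a))) (p ℕD.∣0) ,
  subst ((+ p) ∣_) (sym (∂x a (β ℤ.* a))) (p ℕD.∣0) ,
  subst ((+ p) ∣_) (sym (∂y a (β ℤ.* a ℤ.* a))) p∣βaa
  where
  a : ℤ
  a = aOf α β
  equation : ∀ a1 a2 a3 → + 0 ℤ.* + 0 ℤ.+ a1 ℤ.* + 0 ℤ.* + 0 ℤ.+ a3 ℤ.* + 0 ℤ.- + 0 ℤ.* + 0 ℤ.* + 0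
                          ℤ.- a2 ℤ.* + 0 ℤ.* + 0 ℤ.- + 0 ℤ.* + 0 ℤ.- + 0 ≡ + 0
  equation = ℤSolver.solve-∀
  ∂x : ∀ a1 a2 → a1 ℤ.* + 0 ℤ.- (+ 3) ℤ.* + 0 ℤ.* + 0 ℤ.- (+ 2) ℤ.* a2 ℤ.* + 0 ℤ.- + 0 ≡ + 0
  ∂x = ℤSolver.solve-∀
  ∂y : ∀ a1 a3 → (+ 2) ℤ.* + 0 ℤ.+ a1 ℤ.* + 0 ℤ.+ a3 ≡ a3
  ∂y = ℤSolver.solve-∀
  p∣βaa : (+ p) ∣ (β ℤ.* a ℤ.* a)
  p∣βaa = subst (p ℕD.∣_) (sym (trans (ℤP.abs-* (β ℤ.* a) a) (cong (_* ℤ.∣ a ∣) (ℤP.abs-* β a)))) (divides p∣β⊎p∣a)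
    where
    divides : (+ p) ∣ β ⊎ (+ p) ∣ a → p ℕD.∣ ℤ.∣ β ∣ * ℤ.∣ a ∣ * ℤ.∣ a ∣
    divides (inj₁ p∣β) = ℕD.∣-trans p∣β (ℕD.∣-trans (ℕD.m∣m*n ℤ.∣ a ∣) (ℕD.m∣m*n ℤ.∣ a ∣))
    divides (inj₂ p∣a) = ℕD.∣-trans p∣a (ℕD.n∣m*n (ℤ.∣ β ∣ * ℤ.∣ a ∣))

fueterT-at-0 : ∀ α β → aOf α β ℤ.* β ≢ + 0 → fueterT α β 0ℚ ≡ 1ℚ
fueterT-at-0 α β aβ≢0 = trans (cong (ι (aOf α β ℤ.* β) ⊘_) (ℚP.+-identityˡ (ι (aOf α β ℤ.* β)))) (⊘-self _ (ι-≢0 aβ≢0))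

proposition4p5 : (α β : ℤ) → Coprime ℤ.∣ α ∣ ℤ.∣ β ∣
    → β ≢ + 0 → α ℤ.- (+ 8) ℤ.* β ≢ + 0 → α ℤ.+ (+ 8) ℤ.* β ≢ + 0
    → (p : ℕ) → Prime p → p ≢ 2
    → ((+ p) ∣ β ⊎ (+ p) ∣ (α ℤ.+ (+ 8) ℤ.* β))
    → ¬ ((+ p) ∣ β × (+ p) ∣ (α ℤ.+ (+ 8) ℤ.* β))
      × HasOrder (E-ℚ α β) 4 (pt 0ℚ 0ℚ)
      × SingularReduction p (E-ℤ α β) (+ 0) (+ 0)
      × fueterT α β 0ℚ ≡ 1ℚ
      × ((n : ℕ) → n % 2 ≡ 1
          → ((+ p) ∣ β → (e : ℕ) → ValZ p β e
              → ValQ p (Ψ α β n 0ℚ) (+ ((3 ℕ.* n ℕ.* n ∸ 3) / 8 ℕ.* e))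
                × ValQ p (F α β n 1ℚ) (- (+ ((n ℕ.* n ∸ 1) / 8 ℕ.* e))))
          × ((+ p) ∣ (α ℤ.+ (+ 8) ℤ.* β) → (e : ℕ) → ValZ p (α ℤ.+ (+ 8) ℤ.* β) e
              → ValQ p (Ψ α β n 0ℚ) (+ ((5 ℕ.* n ℕ.* n ∸ 5) / 8 ℕ.* e))
                × ValQ p (F α β n 1ℚ) (+ ((n ℕ.* n ∸ 1) / 8 ℕ.* e))))
proposition4p5 α β α⊥β β≢0 _ a≢0 p p-prime _ p∣β⊎p∣a =
  not-both , order-4 , origin-singular α β p∣β⊎p∣a , fueterT-at-0 α β (*-≢0 a≢0 β≢0) ,
  λ n n-odd → (λ p∣β → valuations-if-p∣β n n-odd (λ p∣a → not-both (p∣β , p∣a))) ,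
              (λ p∣a → valuations-if-p∣a n n-odd (λ p∣β → not-both (p∣β , p∣a)))
  where
  open CurveE α β β≢0 a≢0
  open AtPrime p p-prime
  not-both : ¬ ((+ p) ∣ β × (+ p) ∣ (α ℤ.+ (+ 8) ℤ.* β))
  not-both = divides-both-impossible α β α⊥β p-prime
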